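{- Let $n$ be a positive integer, and let $\mathcal{M}^{u_0v_0}_0(G_n)$ be the set of perfect matchings $M$ of $G_n$ such that $u_0v_0\in M$ and $u_jv_j\notin M$ for $j=1,2,\ldots,2n$. Then $$\sum_{M\in\mathcal{M}^{u_0v_0}_0(G_n)}x^{af(G_n,M)}=(x^3+3x^2)^n.$$
   Context: For a positive integer $n$, $G_n$ is the plane graph (a polyomino graph with $4n$ unit square faces) with vertex set $\{u_0,v_0\}\cup\{u_i,v_i,w_i,z_i: 1\le i\le 2n\}$, drawn with $w_i$ at $(i,3)$, $u_i$ at $(i,2)$, $v_i$ at $(i,1)$, $z_i$ at $(i,0)$ (and $u_0$ at $(0,2)$, $v_0$ at $(0,1)$), and edge set consisting of: $u_{i-1}u_i$ and $v_{i-1}v_i$ for $1\le i\le 2n$; $u_iv_i$ for $0\le i\le 2n$; $w_iu_i$ and $v_iz_i$ for $1\le i\le 2n$; $w_{2j-1}w_{2j}$ and $z_{2j-1}z_{2j}$ for $1\le j\le n$. For a perfect matching $M$ of a graph $G$, a set $S'\subseteq E(G)\setminus M$ is an anti-forcing set of $M$ if $G-S'$ has a unique perfect matching (namely $M$); the anti-forcing number $af(G,M)$ is the minimum size of an anti-forcing set of $M$. -}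

module Defs where

open import Data.Nat using (ℕ; zero; suc; _+_; _*_; _∸_; _^_; _⊓_; _≡ᵇ_)
open import Data.Bool using (Bool; true; false; _∧_; _∨_; not; if_then_else_)
open import Data.Product using (_×_; _,_)
open import Data.List using (List; []; _∷_; _++_; map; concatMap; filterᵇ; foldr; upTo; length)
open import Data.Bool.ListAction using (and)
open import Data.Nat.ListAction using (sum)
open import Data.Vec using (Vec; []; _∷_; fromList)

-- Vertices are natural-number labels listed in 'verts';
-- edges are listed (each once) in 'edgeList' as unordered pairs.
-- An edge subset is a Vec Bool of length |E| (characteristic vector).

record Graph : Set where
  field
    verts    : List ℕ
    edgeList : List (ℕ × ℕ)

open Graph public

nE : Graph → ℕ
nE G = length (edgeList G)

EdgeSet : Graph → Set
EdgeSet G = Vec Bool (nE G)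

edges : (G : Graph) → Vec (ℕ × ℕ) (nE G)
edges G = fromList (edgeList G)

allᵇ : {A : Set} → (A → Bool) → List A → Bool
allᵇ p xs = and (map p xs)

allSubsets : (m : ℕ) → List (Vec Bool m)
allSubsets zero    = [] ∷ []
allSubsets (suc m) = map (false ∷_) (allSubsets m) ++ map (true ∷_) (allSubsets m)

size : ∀ {m} → Vec Bool m → ℕ
size []          = 0
size (true ∷ s)  = suc (size s)
size (false ∷ s) = size s

compl : ∀ {m} → Vec Bool m → Vec Bool m
compl []      = []
compl (b ∷ s) = not b ∷ compl s

_⊆ᵇ_ : ∀ {m} → Vec Bool m → Vec Bool m → Bool
[]      ⊆ᵇ []      = true
(a ∷ s) ⊆ᵇ (b ∷ t) = (not a ∨ b) ∧ (s ⊆ᵇ t)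

_==ᵇ_ : ∀ {m} → Vec Bool m → Vec Bool m → Bool
[]      ==ᵇ []      = true
(a ∷ s) ==ᵇ (b ∷ t) = ((a ∧ b) ∨ (not a ∧ not b)) ∧ (s ==ᵇ t)

degIn : ∀ {m} → Vec (ℕ × ℕ) m → Vec Bool m → ℕ → ℕ
degIn []             []          x = 0
degIn ((a , b) ∷ es) (true ∷ s)  x = (if (a ≡ᵇ x) ∨ (b ≡ᵇ x) then 1 else 0) + degIn es s x
degIn (_ ∷ es)       (false ∷ s) x = degIn es s x

hasEdgeIn : ∀ {m} → Vec (ℕ × ℕ) m → Vec Bool m → ℕ → ℕ → Bool
hasEdgeIn []             []          x y = false
hasEdgeIn ((a , b) ∷ es) (true ∷ s)  x y =
  ((a ≡ᵇ x) ∧ (b ≡ᵇ y)) ∨ ((a ≡ᵇ y) ∧ (b ≡ᵇ x)) ∨ hasEdgeIn es s x y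
hasEdgeIn (_ ∷ es)       (false ∷ s) x y = hasEdgeIn es s x y

hasEdge : (G : Graph) → EdgeSet G → ℕ → ℕ → Bool
hasEdge G M x y = hasEdgeIn (edges G) M x y

isPerfectMatching : (G : Graph) → EdgeSet G → Bool
isPerfectMatching G M = allᵇ (λ x → degIn (edges G) M x ≡ᵇ 1) (verts G)

isPMof : (G : Graph) → EdgeSet G → EdgeSet G → Bool
isPMof G H M = (M ⊆ᵇ H) ∧ isPerfectMatching G M

uniquePM : (G : Graph) → EdgeSet G → EdgeSet G → Bool
uniquePM G H M =
  isPMof G H M ∧ allᵇ (λ M' → not (isPMof G H M') ∨ (M' ==ᵇ M)) (allSubsets (nE G))

isAntiForcing : (G : Graph) → EdgeSet G → EdgeSet G → Bool
isAntiForcing G M S = (S ⊆ᵇ compl M) ∧ uniquePM G (compl S) M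

minList : ℕ → List ℕ → ℕ
minList d = foldr _⊓_ d

-- af(G,M): minimum size of an anti-forcing set of M.
-- (For a perfect matching M, S = E \ M is always anti-forcing and has size ≤ |E|,
--  so the default value |E| never affects the minimum.)
af : (G : Graph) → EdgeSet G → ℕ
af G M = minList (nE G) (map size (filterᵇ (isAntiForcing G M) (allSubsets (nE G))))

-- The graph G_n.  Vertex labels: u_0 = 0, v_0 = 1, and for 1 ≤ i ≤ 2n:
-- u_i = 4i, v_i = 4i+1, w_i = 4i+2, z_i = 4i+3.

uV vV wV zV : ℕ → ℕ
uV i = 4 * i
vV i = 4 * i + 1
wV i = 4 * i + 2
zV i = 4 * i + 3

oneTo : ℕ → List ℕ
oneTo k = map suc (upTo k)

Gn : ℕ → Graph
Gn n = record
  { verts    = uV 0 ∷ vV 0 ∷ concatMap (λ i → uV i ∷ vV i ∷ wV i ∷ zV i ∷ []) (oneTo (2 * n))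
  ; edgeList =
         concatMap (λ i → (uV (i ∸ 1) , uV i) ∷ (vV (i ∸ 1) , vV i) ∷ (wV i , uV i) ∷ (vV i , zV i) ∷ [])
                   (oneTo (2 * n))
      ++ map (λ i → (uV i , vV i)) (upTo (suc (2 * n)))
      ++ concatMap (λ j → (wV (2 * j ∸ 1) , wV (2 * j)) ∷ (zV (2 * j ∸ 1) , zV (2 * j)) ∷ [])
                   (oneTo n)
  }

inM0 : (n : ℕ) → EdgeSet (Gn n) → Bool
inM0 n M = isPerfectMatching (Gn n) M
         ∧ hasEdge (Gn n) M (uV 0) (vV 0)
         ∧ allᵇ (λ j → not (hasEdge (Gn n) M (uV j) (vV j))) (oneTo (2 * n))

M0 : (n : ℕ) → List (EdgeSet (Gn n))
M0 n = filterᵇ (inM0 n) (allSubsets (nE (Gn n)))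

afPoly : (n : ℕ) → ℕ → ℕ
afPoly n x = sum (map (λ M → x ^ af (Gn n) M) (M0 n))

{-# OPTIONS --safe #-}

-- G_{n+1} is G_n with a copy of the block formed by columns 2n+1 and 2n+2 attached at u_{2n} and v_{2n}.
-- A perfect matching of G_{n+1} restricts to a matching of G_n in which u_{2n}, v_{2n} are either both
-- covered from outside or both not (G_n minus one of them has an odd number of vertices); for matchings in
-- M₀ the rungs u_{2n+1}v_{2n+1}, u_{2n+2}v_{2n+2} are excluded, which forces the second case.  So M₀(G_{n+1})
-- is M₀(G_n) times the four rung-free perfect matchings of the block.  Anti-forcing is additive: the union
-- of an optimal set for the G_n-part and one of 3 or 2 block edges (3 for the all-horizontal block
-- matching, 2 for the other three) is anti-forcing, and conversely any anti-forcing set restricts to one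
-- of G_n and to a set killing the other perfect matchings of the block.  Each step therefore multiplies the
-- generating function by x³ + 3x².  The facts about the block are checked by computation over its 2¹²
-- edge sets.

module Submission where

open import Defs
open import Algebra.Bundles using (CommutativeMonoid)
open import Algebra.Definitions using (Interchangable)
open import Algebra.Properties.CommutativeSemigroup using (interchange)
open import Data.Bool.Base using (Bool; true; false; _∧_; _∨_; not; if_then_else_; T)
open import Data.Bool.ListAction using (and; any)
open import Data.Bool.Properties
  using (T-∧; T-≡; T-not-≡; ∧-assoc; ∨-assoc; ∧-zeroʳ; ∧-identityʳ; ∨-identityʳ; ∧-commutativeMonoid; ∨-commutativeMonoid)
open import Data.Empty using (⊥; ⊥-elim)
open import Data.List.Base using (List; []; _∷_; _++_; map; filterᵇ; length; concatMap; upTo; _∷ʳ_)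
open import Data.List.Membership.Propositional using (_∈_)
open import Data.List.Membership.Propositional.Properties using (∈-map⁺; ∈-map⁻; ∈-++⁺ˡ; ∈-++⁺ʳ; ∈-filter⁺; ∈-upTo⁺)
open import Data.List.Properties
  using (map-cong; map-++; map-∘; upTo-∷ʳ; map-upTo; ++-assoc; concatMap-++; ++-identityʳ)
open import Data.List.Relation.Unary.All as All using (All; []; _∷_)
import Data.List.Relation.Unary.All.Properties as All
open import Data.List.Relation.Unary.Any using (here; there)
open import Data.Nat.Base using (ℕ; zero; suc; _+_; _*_; _∸_; _^_; _≤_; _<_; _≡ᵇ_; _≤ᵇ_; z≤n; s≤s)
open import Data.Nat.ListAction using (sum)
open import Data.Nat.ListAction.Properties using (sum-++)
open import Data.Nat.Properties
open import Data.Product.Base using (_×_; _,_; proj₁; proj₂; Σ; uncurry)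
open import Data.Sum.Base using (inj₁; inj₂)
open import Data.Vec.Base using (Vec; []; _∷_; fromList)
import Data.Vec.Base as Vec
open import Function.Base using (_∘_)
open import Function.Bundles using (Equivalence)
open import Relation.Binary.PropositionalEquality
open import Relation.Nullary.Decidable using (Dec; yes; no; from-yes; _×-dec_; T?)
open ≡-Reasoning

private
  variable
    A : Set
    a b : Bool
    m : ℕ

T-∧⁺ : T a → T b → T (a ∧ b)
T-∧⁺ p q = Equivalence.from T-∧ (p , q)

T-∧⁻ : T (a ∧ b) → T a × T b
T-∧⁻ = Equivalence.to T-∧

≡true⇒T : b ≡ true → T b
≡true⇒T = Equivalence.from T-≡

T-∨⁺ˡ : T a → T (a ∨ b)
T-∨⁺ˡ {a = true} _ = _

T-∨⁺ʳ : T b → T (a ∨ b)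
T-∨⁺ʳ {a = true}  _ = _
T-∨⁺ʳ {a = false} p = p

T-not⇒¬T : T (not a) → T a → ⊥
T-not⇒¬T {a = false} _ ()

infixr 5 _⇒ᵇ_

_⇒ᵇ_ : Bool → Bool → Bool
a ⇒ᵇ b = not a ∨ b

⇒ᵇ-intro : (T a → T b) → T (a ⇒ᵇ b)
⇒ᵇ-intro {false} _ = _
⇒ᵇ-intro {true}  f = f _

⇒ᵇ-elim : T (a ⇒ᵇ b) → T a → T b
⇒ᵇ-elim {true} p _ = p

allᵇ⁺ : {p : A → Bool} {xs : List A} → All (T ∘ p) xs → T (allᵇ p xs)
allᵇ⁺ []         = _
allᵇ⁺ (px ∷ pxs) = T-∧⁺ px (allᵇ⁺ pxs)

allᵇ⁻ : (p : A → Bool) (xs : List A) → T (allᵇ p xs) → All (T ∘ p) xs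
allᵇ⁻ p []       _ = []
allᵇ⁻ p (x ∷ xs) h = proj₁ (T-∧⁻ {p x} h) ∷ allᵇ⁻ p xs (proj₂ (T-∧⁻ {p x} h))

allᵇ-lookup : (p : A → Bool) (xs : List A) → T (allᵇ p xs) → ∀ {x} → x ∈ xs → T (p x)
allᵇ-lookup p xs h = All.lookup (allᵇ⁻ p xs h)

filterᵇ-∧ : (p q : A → Bool) (xs : List A) → filterᵇ (λ x → p x ∧ q x) xs ≡ filterᵇ q (filterᵇ p xs)
filterᵇ-∧ p q []       = refl
filterᵇ-∧ p q (x ∷ xs) with p x
... | false = filterᵇ-∧ p q xs
... | true  with q x
...   | true  = cong (x ∷_) (filterᵇ-∧ p q xs)
...   | false = filterᵇ-∧ p q xs

≡ᵇ-false : ∀ {m n} → m ≢ n → (m ≡ᵇ n) ≡ false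
≡ᵇ-false {m} {n} m≢n with m ≡ᵇ n in eq
... | false = refl
... | true  = ⊥-elim (m≢n (≡ᵇ⇒≡ m n (≡true⇒T eq)))

allᵇ-++ : (p : A → Bool) (xs ys : List A) → allᵇ p (xs ++ ys) ≡ allᵇ p xs ∧ allᵇ p ys
allᵇ-++ p []       ys = refl
allᵇ-++ p (x ∷ xs) ys = trans (cong (p x ∧_) (allᵇ-++ p xs ys)) (sym (∧-assoc (p x) _ _))

allᵇ-map : {B : Set} (p : B → Bool) (f : A → B) (xs : List A) → allᵇ p (map f xs) ≡ allᵇ (p ∘ f) xs
allᵇ-map p f xs = cong and (sym (map-∘ xs))

allᵇ-cong : {P : A → Set} {p q : A → Bool} {xs : List A} →
            (∀ {x} → P x → p x ≡ q x) → All P xs → allᵇ p xs ≡ allᵇ q xs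
allᵇ-cong p≡q []         = refl
allᵇ-cong p≡q (px ∷ pxs) = cong₂ _∧_ (p≡q px) (allᵇ-cong p≡q pxs)

==ᵇ⇒≡ : {s t : Vec Bool m} → T (s ==ᵇ t) → s ≡ t
==ᵇ⇒≡ {s = []}        {[]}        _ = refl
==ᵇ⇒≡ {s = true ∷ s}  {true ∷ t}  h = cong (true ∷_) (==ᵇ⇒≡ h)
==ᵇ⇒≡ {s = false ∷ s} {false ∷ t} h = cong (false ∷_) (==ᵇ⇒≡ h)

==ᵇ-refl : (s : Vec Bool m) → T (s ==ᵇ s)
==ᵇ-refl []          = _
==ᵇ-refl (true ∷ s)  = ==ᵇ-refl s
==ᵇ-refl (false ∷ s) = ==ᵇ-refl s

⊆ᵇ-compl-comm : (s t : Vec Bool m) → (s ⊆ᵇ compl t) ≡ (t ⊆ᵇ compl s)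
⊆ᵇ-compl-comm []          []          = refl
⊆ᵇ-compl-comm (true ∷ s)  (true ∷ t)  = refl
⊆ᵇ-compl-comm (true ∷ s)  (false ∷ t) = ⊆ᵇ-compl-comm s t
⊆ᵇ-compl-comm (false ∷ s) (true ∷ t)  = ⊆ᵇ-compl-comm s t
⊆ᵇ-compl-comm (false ∷ s) (false ∷ t) = ⊆ᵇ-compl-comm s t

size≤length : (s : Vec Bool m) → size s ≤ m
size≤length []          = z≤n
size≤length (true ∷ s)  = s≤s (size≤length s)
size≤length (false ∷ s) = m≤n⇒m≤1+n (size≤length s)

∈-allSubsets : (s : Vec Bool m) → s ∈ allSubsets m
∈-allSubsets []          = here refl
∈-allSubsets (false ∷ s) = ∈-++⁺ˡ (∈-map⁺ (false ∷_) (∈-allSubsets s))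
∈-allSubsets {suc m} (true ∷ s) =
  ∈-++⁺ʳ (map (false ∷_) (allSubsets m)) (∈-map⁺ (true ∷_) (∈-allSubsets s))

allᵇ-allSubsets⁺ : {p : Vec Bool m → Bool} → (∀ s → T (p s)) → T (allᵇ p (allSubsets m))
allᵇ-allSubsets⁺ h = allᵇ⁺ {xs = allSubsets _} (All.tabulate λ {s} _ → h s)

allᵇ-allSubsets⁻ : (p : Vec Bool m → Bool) → allᵇ p (allSubsets m) ≡ true → ∀ s → T (p s)
allᵇ-allSubsets⁻ p h s = allᵇ-lookup p (allSubsets _) (≡true⇒T h) (∈-allSubsets s)

record AntiForcing (G : Graph) (M S : EdgeSet G) : Set where
  field
    avoids  : T (S ⊆ᵇ compl M)
    perfect : T (isPerfectMatching G M)
    unique  : ∀ M′ → T (M′ ⊆ᵇ compl S) → T (isPerfectMatching G M′) → M′ ≡ M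

module _ {G : Graph} {M S : EdgeSet G} where

  antiForcing⁺ : AntiForcing G M S → T (isAntiForcing G M S)
  antiForcing⁺ af =
    T-∧⁺ avoids
      (T-∧⁺ (T-∧⁺ (subst T (⊆ᵇ-compl-comm S M) avoids) perfect)
               (allᵇ-allSubsets⁺ λ M′ → ⇒ᵇ-intro λ h →
                  let M′⊆ , M′-perfect = T-∧⁻ {M′ ⊆ᵇ compl S} h
                  in subst (λ N → T (M′ ==ᵇ N)) (unique M′ M′⊆ M′-perfect) (==ᵇ-refl M′)))
    where open AntiForcing af

  antiForcing⁻ : T (isAntiForcing G M S) → AntiForcing G M S
  antiForcing⁻ h = record
    { avoids  = S⊆
    ; perfect = proj₂ (T-∧⁻ {M ⊆ᵇ compl S} M-pm)
    ; unique  = λ M′ M′⊆ M′-perfect →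
        ==ᵇ⇒≡ (⇒ᵇ-elim (allᵇ-allSubsets⁻ _ (Equivalence.to T-≡ unique-pm) M′)
                       (T-∧⁺ {M′ ⊆ᵇ compl S} M′⊆ M′-perfect))
    }
    where
    S⊆ = proj₁ (T-∧⁻ {S ⊆ᵇ compl M} h)
    M-pm = proj₁ (T-∧⁻ {isPMof G (compl S) M} (proj₂ (T-∧⁻ {S ⊆ᵇ compl M} h)))
    unique-pm = proj₂ (T-∧⁻ {isPMof G (compl S) M} (proj₂ (T-∧⁻ {S ⊆ᵇ compl M} h)))

record Optimal (G : Graph) (M S : EdgeSet G) : Set where
  field
    antiForcing : AntiForcing G M S
    minimal     : ∀ S′ → AntiForcing G M S′ → size S ≤ size S′

minList≤ : ∀ d {k} (ks : List ℕ) → k ∈ ks → minList d ks ≤ k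
minList≤ d (k ∷ ks) (here refl) = m⊓n≤m k (minList d ks)
minList≤ d (k ∷ ks) (there k∈) = ≤-trans (m⊓n≤n k (minList d ks)) (minList≤ d ks k∈)

≤minList : ∀ {d k} (ks : List ℕ) → k ≤ d → All (k ≤_) ks → k ≤ minList d ks
≤minList []       k≤d []           = k≤d
≤minList (_ ∷ ks) k≤d (k≤k′ ∷ k≤ks) = ⊓-glb k≤k′ (≤minList ks k≤d k≤ks)

module _ {G : Graph} {M : EdgeSet G} where

  af≤ : ∀ {S} → AntiForcing G M S → af G M ≤ size S
  af≤ {S} h = minList≤ (nE G) _
    (∈-map⁺ size (∈-filter⁺ (T? ∘ isAntiForcing G M) (∈-allSubsets S) (antiForcing⁺ h)))

  af-optimal : ∀ {S} → Optimal G M S → af G M ≡ size S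
  af-optimal {S} opt =
    ≤-antisym (af≤ antiForcing) (≤minList _ (size≤length S) (lowerBounds (allSubsets (nE G))))
    where
    open Optimal opt
    lowerBounds : ∀ Ss → All (size S ≤_) (map size (filterᵇ (isAntiForcing G M) Ss))
    lowerBounds []        = []
    lowerBounds (S′ ∷ Ss) with isAntiForcing G M S′ in eq
    ... | true  = minimal S′ (antiForcing⁻ (≡true⇒T eq)) ∷ lowerBounds Ss
    ... | false = lowerBounds Ss

-- Sums over edge subsets

sum-map-+ : (f g : A → ℕ) (xs : List A) →
            sum (map (λ x → f x + g x) xs) ≡ sum (map f xs) + sum (map g xs)
sum-map-+ f g []       = refl
sum-map-+ f g (x ∷ xs) = begin
  (f x + g x) + sum (map (λ x → f x + g x) xs)   ≡⟨ cong ((f x + g x) +_) (sum-map-+ f g xs) ⟩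
  (f x + g x) + (sum (map f xs) + sum (map g xs)) ≡⟨ interchange +-commutativeSemigroup (f x) (g x) _ _ ⟩
  (f x + sum (map f xs)) + (g x + sum (map g xs)) ∎

sum-map-*ˡ : (c : ℕ) (f : A → ℕ) (xs : List A) → sum (map (λ x → c * f x) xs) ≡ c * sum (map f xs)
sum-map-*ˡ c f []       = sym (*-zeroʳ c)
sum-map-*ˡ c f (x ∷ xs) =
  trans (cong (c * f x +_) (sum-map-*ˡ c f xs)) (sym (*-distribˡ-+ c (f x) _))

sum-filterᵇ : (p : A → Bool) (g : A → ℕ) (xs : List A) →
              sum (map g (filterᵇ p xs)) ≡ sum (map (λ x → if p x then g x else 0) xs)
sum-filterᵇ p g []       = refl
sum-filterᵇ p g (x ∷ xs) with p x
... | true  = cong (g x +_) (sum-filterᵇ p g xs)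
... | false = sum-filterᵇ p g xs

-- Opaque, so that sums over the 2¹² edge sets of the block are never unfolded by the conversion checker.
opaque

  sumSubsets : (m : ℕ) → (Vec Bool m → ℕ) → ℕ
  sumSubsets m f = sum (map f (allSubsets m))

  sumSubsets-cong : {f g : Vec Bool m → ℕ} → (∀ s → f s ≡ g s) → sumSubsets m f ≡ sumSubsets m g
  sumSubsets-cong h = cong sum (map-cong h (allSubsets _))

  sumSubsets-filterᵇ : (p : Vec Bool m → Bool) (g : Vec Bool m → ℕ) →
    sum (map g (filterᵇ p (allSubsets m))) ≡ sumSubsets m (λ s → if p s then g s else 0)
  sumSubsets-filterᵇ p g = sum-filterᵇ p g (allSubsets _)

  sumSubsets-*ʳ : (c : ℕ) (f : Vec Bool m → ℕ) → sumSubsets m (λ s → f s * c) ≡ sumSubsets m f * c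
  sumSubsets-*ʳ {m} c f = begin
    sum (map (λ s → f s * c) (allSubsets m)) ≡⟨ cong sum (map-cong (λ s → *-comm (f s) c) (allSubsets m)) ⟩
    sum (map (λ s → c * f s) (allSubsets m)) ≡⟨ sum-map-*ˡ c f (allSubsets m) ⟩
    c * sumSubsets m f                       ≡⟨ *-comm c _ ⟩
    sumSubsets m f * c                       ∎

  sumSubsets-guard : ∀ b (p : Vec Bool m → Bool) (f : Vec Bool m → ℕ) {c} →
    (T b → sumSubsets m (λ s → if p s then f s else 0) ≡ c) →
    sumSubsets m (λ s → if b ∧ p s then f s else 0) ≡ (if b then c else 0)
  sumSubsets-guard {m} false p f _ = sum-map-*ˡ 0 (λ _ → 0) (allSubsets m)
  sumSubsets-guard       true  p f h = h _

  sumSubsets₀ : (f : Vec Bool 0 → ℕ) → sumSubsets 0 f ≡ f []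
  sumSubsets₀ f = +-identityʳ (f [])

  sumSubsets-suc : (f : Vec Bool (suc m) → ℕ) →
    sumSubsets (suc m) f ≡ sumSubsets m (f ∘ (false ∷_)) + sumSubsets m (f ∘ (true ∷_))
  sumSubsets-suc {m} f = begin
    sum (map f (map (false ∷_) (allSubsets m) ++ map (true ∷_) (allSubsets m)))
      ≡⟨ cong sum (map-++ f (map (false ∷_) (allSubsets m)) _) ⟩
    sum (map f (map (false ∷_) (allSubsets m)) ++ map f (map (true ∷_) (allSubsets m)))
      ≡⟨ sum-++ (map f (map (false ∷_) (allSubsets m))) _ ⟩
    sum (map f (map (false ∷_) (allSubsets m))) + sum (map f (map (true ∷_) (allSubsets m)))
      ≡⟨ sym (cong₂ _+_ (cong sum (map-∘ (allSubsets m))) (cong sum (map-∘ (allSubsets m)))) ⟩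
    sumSubsets m (f ∘ (false ∷_)) + sumSubsets m (f ∘ (true ∷_)) ∎

  sumSubsets-swap : ∀ {m k} (f : Vec Bool m → Vec Bool k → ℕ) →
    sumSubsets m (λ s → sumSubsets k (f s)) ≡ sumSubsets k (λ t → sumSubsets m (λ s → f s t))
  sumSubsets-swap {m} {k} f = go (allSubsets m)
    where
    go : (ss : List (Vec Bool m)) →
         sum (map (λ s → sumSubsets k (f s)) ss) ≡ sumSubsets k (λ t → sum (map (λ s → f s t) ss))
    go []       = sym (sum-map-*ˡ 0 (λ _ → 0) (allSubsets k))
    go (s ∷ ss) = trans (cong (sumSubsets k (f s) +_) (go ss))
                        (sym (sum-map-+ (f s) (λ t → sum (map (λ s → f s t) ss)) (allSubsets k)))

module _ {A : Set} where

  join : (xs ys : List A) → Vec Bool (length xs) → Vec Bool (length ys) → Vec Bool (length (xs ++ ys))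
  join []       ys []      w = w
  join (x ∷ xs) ys (b ∷ u) w = b ∷ join xs ys u w

  split : (xs ys : List A) → Vec Bool (length (xs ++ ys)) → Vec Bool (length xs) × Vec Bool (length ys)
  split []       ys v       = [] , v
  split (x ∷ xs) ys (b ∷ v) = let u , w = split xs ys v in b ∷ u , w

  join-split : (xs ys : List A) (v : Vec Bool (length (xs ++ ys))) → uncurry (join xs ys) (split xs ys v) ≡ v
  join-split []       ys v       = refl
  join-split (x ∷ xs) ys (b ∷ v) = cong (b ∷_) (join-split xs ys v)

  split-join : (xs ys : List A) → ∀ u w → split xs ys (join xs ys u w) ≡ (u , w)
  split-join []       ys []      w = refl
  split-join (x ∷ xs) ys (b ∷ u) w = cong (λ (u , w) → b ∷ u , w) (split-join xs ys u w)

  size-join : (xs ys : List A) → ∀ u w → size (join xs ys u w) ≡ size u + size w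
  size-join []       ys []          w = refl
  size-join (x ∷ xs) ys (true ∷ u)  w = cong suc (size-join xs ys u w)
  size-join (x ∷ xs) ys (false ∷ u) w = size-join xs ys u w

  compl-join : (xs ys : List A) → ∀ u w → compl (join xs ys u w) ≡ join xs ys (compl u) (compl w)
  compl-join []       ys []      w = refl
  compl-join (x ∷ xs) ys (b ∷ u) w = cong (not b ∷_) (compl-join xs ys u w)

  ⊆ᵇ-join : (xs ys : List A) → ∀ u w u′ w′ → (join xs ys u w ⊆ᵇ join xs ys u′ w′) ≡ (u ⊆ᵇ u′) ∧ (w ⊆ᵇ w′)
  ⊆ᵇ-join []       ys []      w []       w′ = refl
  ⊆ᵇ-join (x ∷ xs) ys (b ∷ u) w (b′ ∷ u′) w′ =
    trans (cong ((not b ∨ b′) ∧_) (⊆ᵇ-join xs ys u w u′ w′)) (sym (∧-assoc (not b ∨ b′) _ _))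

  sumSubsets-join : (xs ys : List A) (f : Vec Bool (length (xs ++ ys)) → ℕ) →
    sumSubsets (length (xs ++ ys)) f ≡
    sumSubsets (length xs) (λ u → sumSubsets (length ys) (λ w → f (join xs ys u w)))
  sumSubsets-join []       ys f = sym (sumSubsets₀ (λ u → sumSubsets (length ys) (λ w → f (join [] ys u w))))
  sumSubsets-join (x ∷ xs) ys f = begin
    sumSubsets (suc (length (xs ++ ys))) f
      ≡⟨ sumSubsets-suc f ⟩
    sumSubsets _ (f ∘ (false ∷_)) + sumSubsets _ (f ∘ (true ∷_))
      ≡⟨ cong₂ _+_ (sumSubsets-join xs ys (f ∘ (false ∷_))) (sumSubsets-join xs ys (f ∘ (true ∷_))) ⟩
    sumSubsets (length xs) (λ u → sumSubsets (length ys) (λ w → f (false ∷ join xs ys u w)))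
      + sumSubsets (length xs) (λ u → sumSubsets (length ys) (λ w → f (true ∷ join xs ys u w)))
      ≡⟨ sumSubsets-suc (λ u → sumSubsets (length ys) (λ w → f (join (x ∷ xs) ys u w))) ⟨
    sumSubsets (suc (length xs)) (λ u → sumSubsets (length ys) (λ w → f (join (x ∷ xs) ys u w))) ∎

degIn-join : (xs ys : List (ℕ × ℕ)) → ∀ u w (z : ℕ) →
  degIn (fromList (xs ++ ys)) (join xs ys u w) z ≡ degIn (fromList xs) u z + degIn (fromList ys) w z
degIn-join []             ys []          w z = refl
degIn-join ((a , b) ∷ xs) ys (true ∷ u)  w z =
  trans (cong (_ +_) (degIn-join xs ys u w z))
        (sym (+-assoc (if (a ≡ᵇ z) ∨ (b ≡ᵇ z) then 1 else 0) (degIn (fromList xs) u z) _))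
degIn-join (_ ∷ xs)       ys (false ∷ u) w z = degIn-join xs ys u w z

hasEdgeIn-join : (xs ys : List (ℕ × ℕ)) → ∀ u w (z z′ : ℕ) →
  hasEdgeIn (fromList (xs ++ ys)) (join xs ys u w) z z′ ≡ hasEdgeIn (fromList xs) u z z′ ∨ hasEdgeIn (fromList ys) w z z′
hasEdgeIn-join []             ys []          w z z′ = refl
hasEdgeIn-join ((a , b) ∷ xs) ys (true ∷ u)  w z z′ =
  trans (cong (λ h → ((a ≡ᵇ z) ∧ (b ≡ᵇ z′)) ∨ ((a ≡ᵇ z′) ∧ (b ≡ᵇ z)) ∨ h) (hasEdgeIn-join xs ys u w z z′))
    (trans (cong (((a ≡ᵇ z) ∧ (b ≡ᵇ z′)) ∨_) (sym (∨-assoc ((a ≡ᵇ z′) ∧ (b ≡ᵇ z)) _ _)))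
           (sym (∨-assoc ((a ≡ᵇ z) ∧ (b ≡ᵇ z′)) _ _)))
hasEdgeIn-join (_ ∷ xs)       ys (false ∷ u) w z z′ = hasEdgeIn-join xs ys u w z z′

module _ {A : Set} where

  private
    V : List A → Set
    V zs = Vec Bool (length zs)

  sumOver : (zs : List A) → (V zs → ℕ) → ℕ
  sumOver zs = sumSubsets (length zs)

  syntax sumOver zs (λ u → e) = ∑[ u ⊆ zs ] e

  join₃ : (Z₁ Z₂ Z₃ : List A) → V Z₁ → V Z₂ → V Z₃ → V (Z₁ ++ (Z₂ ++ Z₃))
  join₃ Z₁ Z₂ Z₃ u₁ u₂ u₃ = join Z₁ (Z₂ ++ Z₃) u₁ (join Z₂ Z₃ u₂ u₃)

  join₃-elim : ∀ Z₁ Z₂ Z₃ (P : V (Z₁ ++ (Z₂ ++ Z₃)) → Set) →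
               (∀ u₁ u₂ u₃ → P (join₃ Z₁ Z₂ Z₃ u₁ u₂ u₃)) → ∀ u → P u
  join₃-elim Z₁ Z₂ Z₃ P h u = subst P eq (h u₁ u₂ u₃)
    where
    u₁ = proj₁ (split Z₁ (Z₂ ++ Z₃) u)
    u₂ = proj₁ (split Z₂ Z₃ (proj₂ (split Z₁ (Z₂ ++ Z₃) u)))
    u₃ = proj₂ (split Z₂ Z₃ (proj₂ (split Z₁ (Z₂ ++ Z₃) u)))
    eq = trans (cong (join Z₁ (Z₂ ++ Z₃) u₁) (join-split Z₂ Z₃ _)) (join-split Z₁ (Z₂ ++ Z₃) u)

  sumOver₃ : ∀ Z₁ Z₂ Z₃ (f : V (Z₁ ++ (Z₂ ++ Z₃)) → ℕ) →
             sumOver (Z₁ ++ (Z₂ ++ Z₃)) f ≡ ∑[ u₁ ⊆ Z₁ ] ∑[ u₂ ⊆ Z₂ ] ∑[ u₃ ⊆ Z₃ ] f (join₃ Z₁ Z₂ Z₃ u₁ u₂ u₃)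
  sumOver₃ Z₁ Z₂ Z₃ f = trans (sumSubsets-join Z₁ (Z₂ ++ Z₃) f)
    (sumSubsets-cong λ u₁ → sumSubsets-join Z₂ Z₃ (f ∘ join Z₁ (Z₂ ++ Z₃) u₁))

-- X and Y are the edge lists of two graphs, each in three groups; XY interleaves them group by group,
-- which is how the edge list of G_{n+1} arises from those of G_n and of the block.
module Weaving {A : Set} (X₁ X₂ X₃ Y₁ Y₂ Y₃ : List A) where

  private
    V : List A → Set
    V zs = Vec Bool (length zs)

  X Y XY : List A
  X  = X₁ ++ (X₂ ++ X₃)
  Y  = Y₁ ++ (Y₂ ++ Y₃)
  XY = (X₁ ++ Y₁) ++ ((X₂ ++ Y₂) ++ (X₃ ++ Y₃))

  weave₆ : V X₁ → V Y₁ → V X₂ → V Y₂ → V X₃ → V Y₃ → V XY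
  weave₆ p₁ q₁ p₂ q₂ p₃ q₃ =
    join₃ (X₁ ++ Y₁) (X₂ ++ Y₂) (X₃ ++ Y₃) (join X₁ Y₁ p₁ q₁) (join X₂ Y₂ p₂ q₂) (join X₃ Y₃ p₃ q₃)

  weave : V X → V Y → V XY
  weave p q = weave₆ p₁ q₁ p₂ q₂ p₃ q₃
    where
    p₁ = proj₁ (split X₁ (X₂ ++ X₃) p)
    p₂ = proj₁ (split X₂ X₃ (proj₂ (split X₁ (X₂ ++ X₃) p)))
    p₃ = proj₂ (split X₂ X₃ (proj₂ (split X₁ (X₂ ++ X₃) p)))
    q₁ = proj₁ (split Y₁ (Y₂ ++ Y₃) q)
    q₂ = proj₁ (split Y₂ Y₃ (proj₂ (split Y₁ (Y₂ ++ Y₃) q)))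
    q₃ = proj₂ (split Y₂ Y₃ (proj₂ (split Y₁ (Y₂ ++ Y₃) q)))

  weave-join₃ : ∀ p₁ p₂ p₃ q₁ q₂ q₃ →
    weave (join₃ X₁ X₂ X₃ p₁ p₂ p₃) (join₃ Y₁ Y₂ Y₃ q₁ q₂ q₃) ≡ weave₆ p₁ q₁ p₂ q₂ p₃ q₃
  weave-join₃ p₁ p₂ p₃ q₁ q₂ q₃
    rewrite split-join X₁ (X₂ ++ X₃) p₁ (join X₂ X₃ p₂ p₃) | split-join X₂ X₃ p₂ p₃
          | split-join Y₁ (Y₂ ++ Y₃) q₁ (join Y₂ Y₃ q₂ q₃) | split-join Y₂ Y₃ q₂ q₃ = refl

  weave-elim : (P : V XY → Set) → (∀ p q → P (weave p q)) → ∀ v → P v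
  weave-elim P h = join₃-elim (X₁ ++ Y₁) (X₂ ++ Y₂) (X₃ ++ Y₃) P λ u₁ u₂ u₃ →
    subst P (cong₂ (λ v₁ v₂₃ → join (X₁ ++ Y₁) _ v₁ v₂₃) (join-split X₁ Y₁ u₁)
              (cong₂ (join (X₂ ++ Y₂) (X₃ ++ Y₃)) (join-split X₂ Y₂ u₂) (join-split X₃ Y₃ u₃)))
      (subst P (weave-join₃ _ _ _ _ _ _) (h _ _))

  weave-hom₂ : {C : Set} (_∙_ : C → C → C) → Interchangable _≡_ _∙_ _∙_ →
    (f : (zs : List A) → V zs → V zs → C) →
    (∀ zs ws u w u′ w′ → f (zs ++ ws) (join zs ws u w) (join zs ws u′ w′) ≡ f zs u u′ ∙ f ws w w′) →
    ∀ p q p′ q′ → f XY (weave p q) (weave p′ q′) ≡ f X p p′ ∙ f Y q q′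
  weave-hom₂ _∙_ interchange f f-join =
    join₃-elim X₁ X₂ X₃ _ λ p₁ p₂ p₃ → join₃-elim Y₁ Y₂ Y₃ _ λ q₁ q₂ q₃ →
    join₃-elim X₁ X₂ X₃ _ λ p₁′ p₂′ p₃′ → join₃-elim Y₁ Y₂ Y₃ _ λ q₁′ q₂′ q₃′ →
    let hom₃ : ∀ Z₁ Z₂ Z₃ u₁ u₂ u₃ u₁′ u₂′ u₃′ →
               f (Z₁ ++ (Z₂ ++ Z₃)) (join₃ Z₁ Z₂ Z₃ u₁ u₂ u₃) (join₃ Z₁ Z₂ Z₃ u₁′ u₂′ u₃′)
               ≡ f Z₁ u₁ u₁′ ∙ (f Z₂ u₂ u₂′ ∙ f Z₃ u₃ u₃′)
        hom₃ Z₁ Z₂ Z₃ u₁ u₂ u₃ u₁′ u₂′ u₃′ =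
          trans (f-join Z₁ (Z₂ ++ Z₃) _ _ _ _) (cong (f Z₁ u₁ u₁′ ∙_) (f-join Z₂ Z₃ _ _ _ _))
    in begin
    f XY (weave (join₃ X₁ X₂ X₃ p₁ p₂ p₃) (join₃ Y₁ Y₂ Y₃ q₁ q₂ q₃))
         (weave (join₃ X₁ X₂ X₃ p₁′ p₂′ p₃′) (join₃ Y₁ Y₂ Y₃ q₁′ q₂′ q₃′))
      ≡⟨ cong₂ (f XY) (weave-join₃ p₁ p₂ p₃ q₁ q₂ q₃) (weave-join₃ p₁′ p₂′ p₃′ q₁′ q₂′ q₃′) ⟩
    f XY (weave₆ p₁ q₁ p₂ q₂ p₃ q₃) (weave₆ p₁′ q₁′ p₂′ q₂′ p₃′ q₃′)
      ≡⟨ hom₃ (X₁ ++ Y₁) (X₂ ++ Y₂) (X₃ ++ Y₃) _ _ _ _ _ _ ⟩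
    f (X₁ ++ Y₁) _ _ ∙ (f (X₂ ++ Y₂) _ _ ∙ f (X₃ ++ Y₃) _ _)
      ≡⟨ cong₂ (λ a b → a ∙ (b ∙ f (X₃ ++ Y₃) _ _)) (f-join X₁ Y₁ _ _ _ _) (f-join X₂ Y₂ _ _ _ _) ⟩
    (f X₁ p₁ p₁′ ∙ f Y₁ q₁ q₁′) ∙ ((f X₂ p₂ p₂′ ∙ f Y₂ q₂ q₂′) ∙ f (X₃ ++ Y₃) _ _)
      ≡⟨ cong (λ c → (f X₁ p₁ p₁′ ∙ f Y₁ q₁ q₁′) ∙ ((f X₂ p₂ p₂′ ∙ f Y₂ q₂ q₂′) ∙ c)) (f-join X₃ Y₃ _ _ _ _) ⟩
    (f X₁ p₁ p₁′ ∙ f Y₁ q₁ q₁′) ∙ ((f X₂ p₂ p₂′ ∙ f Y₂ q₂ q₂′) ∙ (f X₃ p₃ p₃′ ∙ f Y₃ q₃ q₃′))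
      ≡⟨ cong ((f X₁ p₁ p₁′ ∙ f Y₁ q₁ q₁′) ∙_) (interchange _ _ _ _) ⟩
    (f X₁ p₁ p₁′ ∙ f Y₁ q₁ q₁′) ∙ ((f X₂ p₂ p₂′ ∙ f X₃ p₃ p₃′) ∙ (f Y₂ q₂ q₂′ ∙ f Y₃ q₃ q₃′))
      ≡⟨ interchange _ _ _ _ ⟩
    (f X₁ p₁ p₁′ ∙ (f X₂ p₂ p₂′ ∙ f X₃ p₃ p₃′)) ∙ (f Y₁ q₁ q₁′ ∙ (f Y₂ q₂ q₂′ ∙ f Y₃ q₃ q₃′))
      ≡⟨ sym (cong₂ _∙_ (hom₃ X₁ X₂ X₃ _ _ _ _ _ _) (hom₃ Y₁ Y₂ Y₃ _ _ _ _ _ _)) ⟩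
    f X (join₃ X₁ X₂ X₃ p₁ p₂ p₃) (join₃ X₁ X₂ X₃ p₁′ p₂′ p₃′)
      ∙ f Y (join₃ Y₁ Y₂ Y₃ q₁ q₂ q₃) (join₃ Y₁ Y₂ Y₃ q₁′ q₂′ q₃′) ∎

  weave-hom : {C : Set} (_∙_ : C → C → C) → Interchangable _≡_ _∙_ _∙_ →
    (f : (zs : List A) → V zs → C) →
    (∀ zs ws u w → f (zs ++ ws) (join zs ws u w) ≡ f zs u ∙ f ws w) →
    ∀ p q → f XY (weave p q) ≡ f X p ∙ f Y q
  weave-hom _∙_ interchange f f-join p q =
    weave-hom₂ _∙_ interchange (λ zs u _ → f zs u) (λ zs ws u w _ _ → f-join zs ws u w) p q p q

  private
    compl-join₃ : ∀ (Z₁ Z₂ Z₃ : List A) u₁ u₂ u₃ →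
      compl (join₃ Z₁ Z₂ Z₃ u₁ u₂ u₃) ≡ join₃ Z₁ Z₂ Z₃ (compl u₁) (compl u₂) (compl u₃)
    compl-join₃ Z₁ Z₂ Z₃ u₁ u₂ u₃ =
      trans (compl-join Z₁ (Z₂ ++ Z₃) u₁ _) (cong (join Z₁ (Z₂ ++ Z₃) (compl u₁)) (compl-join Z₂ Z₃ u₂ u₃))

  compl-weave : ∀ p q → compl (weave p q) ≡ weave (compl p) (compl q)
  compl-weave = join₃-elim X₁ X₂ X₃ _ λ p₁ p₂ p₃ → join₃-elim Y₁ Y₂ Y₃ _ λ q₁ q₂ q₃ → begin
    compl (weave (join₃ X₁ X₂ X₃ p₁ p₂ p₃) (join₃ Y₁ Y₂ Y₃ q₁ q₂ q₃))
      ≡⟨ cong compl (weave-join₃ p₁ p₂ p₃ q₁ q₂ q₃) ⟩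
    compl (weave₆ p₁ q₁ p₂ q₂ p₃ q₃)
      ≡⟨ compl-join₃ (X₁ ++ Y₁) (X₂ ++ Y₂) (X₃ ++ Y₃) (join X₁ Y₁ p₁ q₁) (join X₂ Y₂ p₂ q₂) (join X₃ Y₃ p₃ q₃) ⟩
    join₃ (X₁ ++ Y₁) (X₂ ++ Y₂) (X₃ ++ Y₃) (compl (join X₁ Y₁ p₁ q₁)) (compl (join X₂ Y₂ p₂ q₂)) (compl (join X₃ Y₃ p₃ q₃))
      ≡⟨ cong₃ (join₃ (X₁ ++ Y₁) (X₂ ++ Y₂) (X₃ ++ Y₃)) (compl-join X₁ Y₁ p₁ q₁) (compl-join X₂ Y₂ p₂ q₂) (compl-join X₃ Y₃ p₃ q₃) ⟩
    weave₆ (compl p₁) (compl q₁) (compl p₂) (compl q₂) (compl p₃) (compl q₃)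
      ≡⟨ weave-join₃ _ _ _ _ _ _ ⟨
    weave (join₃ X₁ X₂ X₃ (compl p₁) (compl p₂) (compl p₃)) (join₃ Y₁ Y₂ Y₃ (compl q₁) (compl q₂) (compl q₃))
      ≡⟨ cong₂ weave (compl-join₃ X₁ X₂ X₃ p₁ p₂ p₃) (compl-join₃ Y₁ Y₂ Y₃ q₁ q₂ q₃) ⟨
    weave (compl (join₃ X₁ X₂ X₃ p₁ p₂ p₃)) (compl (join₃ Y₁ Y₂ Y₃ q₁ q₂ q₃)) ∎
    where
    cong₃ : ∀ {B C D E : Set} (f : B → C → D → E) {b b′ c c′ d d′} → b ≡ b′ → c ≡ c′ → d ≡ d′ → f b c d ≡ f b′ c′ d′
    cong₃ f refl refl refl = refl

  unweave : V XY → V X × V Y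
  unweave v = join₃ X₁ X₂ X₃ p₁ p₂ p₃ , join₃ Y₁ Y₂ Y₃ q₁ q₂ q₃
    where
    u₁ = proj₁ (split (X₁ ++ Y₁) ((X₂ ++ Y₂) ++ (X₃ ++ Y₃)) v)
    u₂₃ = proj₂ (split (X₁ ++ Y₁) ((X₂ ++ Y₂) ++ (X₃ ++ Y₃)) v)
    u₂ = proj₁ (split (X₂ ++ Y₂) (X₃ ++ Y₃) u₂₃)
    u₃ = proj₂ (split (X₂ ++ Y₂) (X₃ ++ Y₃) u₂₃)
    p₁ = proj₁ (split X₁ Y₁ u₁)
    q₁ = proj₂ (split X₁ Y₁ u₁)
    p₂ = proj₁ (split X₂ Y₂ u₂)
    q₂ = proj₂ (split X₂ Y₂ u₂)
    p₃ = proj₁ (split X₃ Y₃ u₃)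
    q₃ = proj₂ (split X₃ Y₃ u₃)

  unweave-weave : ∀ p q → unweave (weave p q) ≡ (p , q)
  unweave-weave = join₃-elim X₁ X₂ X₃ _ λ p₁ p₂ p₃ → join₃-elim Y₁ Y₂ Y₃ _ λ q₁ q₂ q₃ →
    trans (cong unweave (weave-join₃ p₁ p₂ p₃ q₁ q₂ q₃)) (unweave-weave₆ p₁ p₂ p₃ q₁ q₂ q₃)
    where
    unweave-weave₆ : ∀ p₁ p₂ p₃ q₁ q₂ q₃ →
            unweave (weave₆ p₁ q₁ p₂ q₂ p₃ q₃) ≡ (join₃ X₁ X₂ X₃ p₁ p₂ p₃ , join₃ Y₁ Y₂ Y₃ q₁ q₂ q₃)
    unweave-weave₆ p₁ p₂ p₃ q₁ q₂ q₃
      rewrite split-join (X₁ ++ Y₁) ((X₂ ++ Y₂) ++ (X₃ ++ Y₃)) (join X₁ Y₁ p₁ q₁)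
                (join (X₂ ++ Y₂) (X₃ ++ Y₃) (join X₂ Y₂ p₂ q₂) (join X₃ Y₃ p₃ q₃))
            | split-join (X₂ ++ Y₂) (X₃ ++ Y₃) (join X₂ Y₂ p₂ q₂) (join X₃ Y₃ p₃ q₃)
            | split-join X₁ Y₁ p₁ q₁ | split-join X₂ Y₂ p₂ q₂ | split-join X₃ Y₃ p₃ q₃ = refl

  weave-injective : ∀ {p q p′ q′} → weave p q ≡ weave p′ q′ → p ≡ p′ × q ≡ q′
  weave-injective {p} {q} {p′} {q′} eq with trans (sym (unweave-weave p q)) (trans (cong unweave eq) (unweave-weave p′ q′))
  ... | refl = refl , refl

  sumOver-weave : (g : V XY → ℕ) → sumOver XY g ≡ ∑[ p ⊆ X ] ∑[ q ⊆ Y ] g (weave p q)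
  sumOver-weave g = begin
    sumOver XY g
      ≡⟨ sumOver₃ (X₁ ++ Y₁) (X₂ ++ Y₂) (X₃ ++ Y₃) g ⟩
    ∑[ u₁ ⊆ X₁ ++ Y₁ ] ∑[ u₂ ⊆ X₂ ++ Y₂ ] ∑[ u₃ ⊆ X₃ ++ Y₃ ] g (J₆ u₁ u₂ u₃)
      ≡⟨ sumSubsets-join X₁ Y₁ (λ u₁ → ∑[ u₂ ⊆ X₂ ++ Y₂ ] ∑[ u₃ ⊆ X₃ ++ Y₃ ] g (J₆ u₁ u₂ u₃)) ⟩
    ∑[ p₁ ⊆ X₁ ] ∑[ q₁ ⊆ Y₁ ] ∑[ u₂ ⊆ X₂ ++ Y₂ ] ∑[ u₃ ⊆ X₃ ++ Y₃ ] g (J₆ (join X₁ Y₁ p₁ q₁) u₂ u₃)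
      ≡⟨ (sumSubsets-cong λ p₁ → sumSubsets-cong λ q₁ →
           trans (sumSubsets-join X₂ Y₂ (λ u₂ → ∑[ u₃ ⊆ X₃ ++ Y₃ ] g (J₆ (join X₁ Y₁ p₁ q₁) u₂ u₃)))
           (sumSubsets-cong λ p₂ → sumSubsets-cong λ q₂ →
             sumSubsets-join X₃ Y₃ (λ u₃ → g (J₆ (join X₁ Y₁ p₁ q₁) (join X₂ Y₂ p₂ q₂) u₃)))) ⟩
    ∑[ p₁ ⊆ X₁ ] ∑[ q₁ ⊆ Y₁ ] ∑[ p₂ ⊆ X₂ ] ∑[ q₂ ⊆ Y₂ ] ∑[ p₃ ⊆ X₃ ] ∑[ q₃ ⊆ Y₃ ] G p₁ q₁ p₂ q₂ p₃ q₃
      ≡⟨ (sumSubsets-cong λ p₁ → sumSubsets-swap (λ q₁ p₂ → ∑[ q₂ ⊆ Y₂ ] ∑[ p₃ ⊆ X₃ ] ∑[ q₃ ⊆ Y₃ ] G p₁ q₁ p₂ q₂ p₃ q₃)) ⟩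
    ∑[ p₁ ⊆ X₁ ] ∑[ p₂ ⊆ X₂ ] ∑[ q₁ ⊆ Y₁ ] ∑[ q₂ ⊆ Y₂ ] ∑[ p₃ ⊆ X₃ ] ∑[ q₃ ⊆ Y₃ ] G p₁ q₁ p₂ q₂ p₃ q₃
      ≡⟨ (sumSubsets-cong λ p₁ → sumSubsets-cong λ p₂ → sumSubsets-cong λ q₁ →
           sumSubsets-swap (λ q₂ p₃ → ∑[ q₃ ⊆ Y₃ ] G p₁ q₁ p₂ q₂ p₃ q₃)) ⟩
    ∑[ p₁ ⊆ X₁ ] ∑[ p₂ ⊆ X₂ ] ∑[ q₁ ⊆ Y₁ ] ∑[ p₃ ⊆ X₃ ] ∑[ q₂ ⊆ Y₂ ] ∑[ q₃ ⊆ Y₃ ] G p₁ q₁ p₂ q₂ p₃ q₃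
      ≡⟨ (sumSubsets-cong λ p₁ → sumSubsets-cong λ p₂ →
           sumSubsets-swap (λ q₁ p₃ → ∑[ q₂ ⊆ Y₂ ] ∑[ q₃ ⊆ Y₃ ] G p₁ q₁ p₂ q₂ p₃ q₃)) ⟩
    ∑[ p₁ ⊆ X₁ ] ∑[ p₂ ⊆ X₂ ] ∑[ p₃ ⊆ X₃ ] ∑[ q₁ ⊆ Y₁ ] ∑[ q₂ ⊆ Y₂ ] ∑[ q₃ ⊆ Y₃ ] G p₁ q₁ p₂ q₂ p₃ q₃
      ≡⟨ (sumSubsets-cong λ p₁ → sumSubsets-cong λ p₂ → sumSubsets-cong λ p₃ →
           trans (sumOver₃ Y₁ Y₂ Y₃ _) (sumSubsets-cong λ q₁ → sumSubsets-cong λ q₂ → sumSubsets-cong λ q₃ →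
             cong g (weave-join₃ p₁ p₂ p₃ q₁ q₂ q₃))) ⟨
    ∑[ p₁ ⊆ X₁ ] ∑[ p₂ ⊆ X₂ ] ∑[ p₃ ⊆ X₃ ] ∑[ q ⊆ Y ] g (weave (join₃ X₁ X₂ X₃ p₁ p₂ p₃) q)
      ≡⟨ sumOver₃ X₁ X₂ X₃ _ ⟨
    ∑[ p ⊆ X ] ∑[ q ⊆ Y ] g (weave p q) ∎
    where
    J₆ = join₃ (X₁ ++ Y₁) (X₂ ++ Y₂) (X₃ ++ Y₃)
    G : V X₁ → V Y₁ → V X₂ → V Y₂ → V X₃ → V Y₃ → ℕ
    G p₁ q₁ p₂ q₂ p₃ q₃ = g (weave₆ p₁ q₁ p₂ q₂ p₃ q₃)

-- The graphs G_n

Edge : Set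
Edge = ℕ × ℕ

columnEdges : ℕ → List Edge
columnEdges i = (uV (i ∸ 1) , uV i) ∷ (vV (i ∸ 1) , vV i) ∷ (wV i , uV i) ∷ (vV i , zV i) ∷ []

rungEdge : ℕ → Edge
rungEdge i = uV i , vV i

capEdges : ℕ → List Edge
capEdges j = (wV (2 * j ∸ 1) , wV (2 * j)) ∷ (zV (2 * j ∸ 1) , zV (2 * j)) ∷ []

columnVertices : ℕ → List ℕ
columnVertices i = uV i ∷ vV i ∷ wV i ∷ zV i ∷ []

columns rungs caps : ℕ → List Edge
columns n = concatMap columnEdges (oneTo (2 * n))
rungs n   = map rungEdge (upTo (suc (2 * n)))
caps n    = concatMap capEdges (oneTo n)

shift : ℕ → Edge → Edge
shift k (a , b) = k + a , k + b

-- The block is the part of G₁ that is not in G₀; shifted by 8n it is the part of G_{n+1} not in G_n.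
blockColumns blockRungs blockCaps : List Edge
blockColumns = concatMap columnEdges (oneTo 2)
blockRungs   = map rungEdge (oneTo 2)
blockCaps    = concatMap capEdges (oneTo 1)

blockVertices : List ℕ
blockVertices = concatMap columnVertices (oneTo 2)

block : Graph
block = record
  { verts    = blockVertices
  ; edgeList = blockColumns ++ (blockRungs ++ blockCaps)
  }

module Glued (n : ℕ) =
  Weaving (columns n) (rungs n) (caps n)
          (map (shift (8 * n)) blockColumns) (map (shift (8 * n)) blockRungs) (map (shift (8 * n)) blockCaps)

glued : ℕ → Graph
glued n = record
  { verts    = verts (Gn n) ++ map (8 * n +_) blockVertices
  ; edgeList = Glued.XY n
  }

upTo-+ : ∀ m k → upTo (m + k) ≡ upTo m ++ map (m +_) (upTo k)
upTo-+ m zero    = trans (cong upTo (+-identityʳ m)) (sym (++-identityʳ (upTo m)))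
upTo-+ m (suc k) = begin
  upTo (m + suc k)                                    ≡⟨ cong upTo (+-suc m k) ⟩
  upTo (suc (m + k))                                  ≡⟨ upTo-∷ʳ (m + k) ⟨
  upTo (m + k) ∷ʳ (m + k)                             ≡⟨ cong (_∷ʳ (m + k)) (upTo-+ m k) ⟩
  (upTo m ++ map (m +_) (upTo k)) ∷ʳ (m + k)          ≡⟨ ++-assoc (upTo m) _ _ ⟩
  upTo m ++ (map (m +_) (upTo k) ∷ʳ (m + k))          ≡⟨ cong (upTo m ++_) (map-++ (m +_) (upTo k) _) ⟨
  upTo m ++ map (m +_) (upTo k ∷ʳ k)                  ≡⟨ cong (λ is → upTo m ++ map (m +_) is) (upTo-∷ʳ k) ⟩
  upTo m ++ map (m +_) (upTo (suc k))                 ∎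

oneTo-+ : ∀ m k → oneTo (m + k) ≡ oneTo m ++ map (m +_) (oneTo k)
oneTo-+ m k = begin
  map suc (upTo (m + k))                          ≡⟨ cong (map suc) (upTo-+ m k) ⟩
  map suc (upTo m ++ map (m +_) (upTo k))         ≡⟨ map-++ suc (upTo m) _ ⟩
  oneTo m ++ map suc (map (m +_) (upTo k))        ≡⟨ cong (oneTo m ++_) (map-∘-+ (upTo k)) ⟩
  oneTo m ++ map (m +_) (oneTo k)                 ∎
  where
  map-∘-+ : ∀ is → map suc (map (m +_) is) ≡ map (m +_) (map suc is)
  map-∘-+ []       = refl
  map-∘-+ (i ∷ is) = cong₂ _∷_ (sym (+-suc m i)) (map-∘-+ is)

upTo-suc : ∀ m → upTo (suc m) ≡ 0 ∷ oneTo m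
upTo-suc m = cong (0 ∷_) (sym (map-upTo suc m))

2*suc : ∀ n → 2 * suc n ≡ 2 * n + 2
2*suc n = trans (*-suc 2 n) (+-comm 2 (2 * n))

module _ (n : ℕ) where

  private
    k = 8 * n

  label-shift : ∀ m c → 4 * (2 * n + m) + c ≡ k + (4 * m + c)
  label-shift m c = begin
    4 * (2 * n + m) + c         ≡⟨ cong (_+ c) (*-distribˡ-+ 4 (2 * n) m) ⟩
    4 * (2 * n) + 4 * m + c     ≡⟨ cong (λ t → t + 4 * m + c) (*-assoc 4 2 n) ⟨
    k + 4 * m + c               ≡⟨ +-assoc k (4 * m) c ⟩
    k + (4 * m + c)             ∎

  uV-shift : ∀ m → uV (2 * n + m) ≡ k + uV m
  uV-shift m = trans (sym (+-identityʳ (uV (2 * n + m)))) (trans (label-shift m 0) (cong (k +_) (+-identityʳ (uV m))))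

  private
    pair : ∀ {a b a′ b′} → a ≡ k + a′ → b ≡ k + b′ → (a , b) ≡ shift k (a′ , b′)
    pair = cong₂ _,_

  columnEdges-shift : ∀ i → columnEdges (2 * n + suc i) ≡ map (shift k) (columnEdges (suc i))
  columnEdges-shift i =
    cong₂ _∷_ (pair (trans (cong uV pred) (uV-shift i)) (uV-shift (suc i)))
    (cong₂ _∷_ (pair (trans (cong vV pred) (label-shift i 1)) (label-shift (suc i) 1))
    (cong₂ _∷_ (pair (label-shift (suc i) 2) (uV-shift (suc i)))
    (cong₂ _∷_ (pair (label-shift (suc i) 1) (label-shift (suc i) 3)) refl)))
    where
    pred : 2 * n + suc i ∸ 1 ≡ 2 * n + i
    pred = +-∸-assoc (2 * n) (s≤s (z≤n {i}))

  rungEdge-shift : ∀ i → rungEdge (2 * n + i) ≡ shift k (rungEdge i)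
  rungEdge-shift i = pair (uV-shift i) (label-shift i 1)

  capEdges-shift : capEdges (n + 1) ≡ map (shift k) (capEdges 1)
  capEdges-shift =
    cong₂ _∷_ (pair (trans (cong wV odd) (label-shift 1 2)) (trans (cong wV even) (label-shift 2 2)))
    (cong₂ _∷_ (pair (trans (cong zV odd) (label-shift 1 3)) (trans (cong zV even) (label-shift 2 3))) refl)
    where
    even : 2 * (n + 1) ≡ 2 * n + 2
    even = *-distribˡ-+ 2 n 1
    odd : 2 * (n + 1) ∸ 1 ≡ 2 * n + 1
    odd = trans (cong (_∸ 1) even) (+-∸-assoc (2 * n) (s≤s (z≤n {1})))

  columnVertices-shift : ∀ i → columnVertices (2 * n + i) ≡ map (k +_) (columnVertices i)
  columnVertices-shift i =
    cong₂ _∷_ (uV-shift i) (cong₂ _∷_ (label-shift i 1) (cong₂ _∷_ (label-shift i 2) (cong₂ _∷_ (label-shift i 3) refl)))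

  oneTo-2*suc : oneTo (2 * suc n) ≡ oneTo (2 * n) ++ (2 * n + 1 ∷ 2 * n + 2 ∷ [])
  oneTo-2*suc = trans (cong oneTo (2*suc n)) (oneTo-+ (2 * n) 2)

  columns-suc : columns (suc n) ≡ columns n ++ map (shift k) blockColumns
  columns-suc = begin
    concatMap columnEdges (oneTo (2 * suc n))
      ≡⟨ cong (concatMap columnEdges) oneTo-2*suc ⟩
    concatMap columnEdges (oneTo (2 * n) ++ (2 * n + 1 ∷ 2 * n + 2 ∷ []))
      ≡⟨ concatMap-++ columnEdges (oneTo (2 * n)) _ ⟩
    columns n ++ (columnEdges (2 * n + 1) ++ (columnEdges (2 * n + 2) ++ []))
      ≡⟨ cong (columns n ++_) (cong₂ _++_ (columnEdges-shift 0) (cong (_++ []) (columnEdges-shift 1))) ⟩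
    columns n ++ map (shift k) blockColumns ∎

  rungs-suc : rungs (suc n) ≡ rungs n ++ map (shift k) blockRungs
  rungs-suc = begin
    map rungEdge (upTo (suc (2 * suc n)))
      ≡⟨ cong (map rungEdge) (trans (upTo-suc (2 * suc n)) (cong (0 ∷_) oneTo-2*suc)) ⟩
    rungEdge 0 ∷ map rungEdge (oneTo (2 * n) ++ (2 * n + 1 ∷ 2 * n + 2 ∷ []))
      ≡⟨ cong (rungEdge 0 ∷_) (map-++ rungEdge (oneTo (2 * n)) _) ⟩
    rungEdge 0 ∷ (map rungEdge (oneTo (2 * n)) ++ (rungEdge (2 * n + 1) ∷ rungEdge (2 * n + 2) ∷ []))
      ≡⟨ cong₂ (λ rs new → rungEdge 0 ∷ (map rungEdge rs ++ new)) (map-upTo suc (2 * n))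
           (cong₂ _∷_ (rungEdge-shift 1) (cong₂ _∷_ (rungEdge-shift 2) refl)) ⟩
    map rungEdge (upTo (suc (2 * n))) ++ map (shift k) blockRungs ∎

  caps-suc : caps (suc n) ≡ caps n ++ map (shift k) blockCaps
  caps-suc = begin
    concatMap capEdges (oneTo (suc n))
      ≡⟨ cong (concatMap capEdges ∘ oneTo) (+-comm 1 n) ⟩
    concatMap capEdges (oneTo (n + 1))
      ≡⟨ cong (concatMap capEdges) (oneTo-+ n 1) ⟩
    concatMap capEdges (oneTo n ++ (n + 1 ∷ []))
      ≡⟨ concatMap-++ capEdges (oneTo n) _ ⟩
    caps n ++ (capEdges (n + 1) ++ [])
      ≡⟨ cong (λ cs → caps n ++ (cs ++ [])) capEdges-shift ⟩
    caps n ++ map (shift k) blockCaps ∎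

  vertices-suc : verts (Gn (suc n)) ≡ verts (Gn n) ++ map (k +_) blockVertices
  vertices-suc = cong (λ vs → uV 0 ∷ vV 0 ∷ vs) (begin
    concatMap columnVertices (oneTo (2 * suc n))
      ≡⟨ cong (concatMap columnVertices) oneTo-2*suc ⟩
    concatMap columnVertices (oneTo (2 * n) ++ (2 * n + 1 ∷ 2 * n + 2 ∷ []))
      ≡⟨ concatMap-++ columnVertices (oneTo (2 * n)) _ ⟩
    concatMap columnVertices (oneTo (2 * n)) ++ (columnVertices (2 * n + 1) ++ (columnVertices (2 * n + 2) ++ []))
      ≡⟨ cong (concatMap columnVertices (oneTo (2 * n)) ++_)
           (cong₂ _++_ (columnVertices-shift 1) (cong (_++ []) (columnVertices-shift 2))) ⟩
    concatMap columnVertices (oneTo (2 * n)) ++ map (k +_) blockVertices ∎)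

  Gn-suc : Gn (suc n) ≡ glued n
  Gn-suc = cong₂ (λ vs es → record { verts = vs ; edgeList = es }) vertices-suc
             (cong₂ _++_ columns-suc (cong₂ _++_ rungs-suc caps-suc))

oneTo-≤ : ∀ m → All (_≤ m) (oneTo m)
oneTo-≤ m = All.map⁺ (All.all-upTo m)

incident : ℕ → Edge → Bool
incident x (a , b) = (a ≡ᵇ x) ∨ (b ≡ᵇ x)

degIn-nonincident : ∀ (es : List Edge) s x → All (λ e → T (not (incident x e))) es → degIn (fromList es) s x ≡ 0
degIn-nonincident []             []          x []      = refl
degIn-nonincident ((a , b) ∷ es) (true ∷ s)  x (h ∷ hs) with (a ≡ᵇ x) ∨ (b ≡ᵇ x)
... | false = degIn-nonincident es s x hs
degIn-nonincident (_ ∷ es)       (false ∷ s) x (_ ∷ hs) = degIn-nonincident es s x hs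

hasEdgeIn-nonincident : ∀ (es : List Edge) s x y → All (λ e → T (not (incident x e))) es →
                        hasEdgeIn (fromList es) s x y ≡ false
hasEdgeIn-nonincident []             []          x y []       = refl
hasEdgeIn-nonincident ((a , b) ∷ es) (true ∷ s)  x y (h ∷ hs) with a ≡ᵇ x | b ≡ᵇ x
... | false | false rewrite ∧-zeroʳ (a ≡ᵇ y) = hasEdgeIn-nonincident es s x y hs
hasEdgeIn-nonincident (_ ∷ es)       (false ∷ s) x y (_ ∷ hs) = hasEdgeIn-nonincident es s x y hs

≡ᵇ-+ : ∀ k a b → (k + a ≡ᵇ k + b) ≡ (a ≡ᵇ b)
≡ᵇ-+ zero    a b = refl
≡ᵇ-+ (suc k) a b = ≡ᵇ-+ k a b

private
  ≡ᵇ-false-< : ∀ {a x} → x < a → (a ≡ᵇ x) ≡ false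
  ≡ᵇ-false-< x<a = ≡ᵇ-false (λ a≡x → <-irrefl (sym a≡x) x<a)

module _ (k : ℕ) where

  degIn-shift : ∀ {m} (v : Vec Edge m) s y → degIn (Vec.map (shift k) v) s (k + y) ≡ degIn v s y
  degIn-shift []             []          y = refl
  degIn-shift ((a , b) ∷ v)  (true ∷ s)  y
    rewrite ≡ᵇ-+ k a y | ≡ᵇ-+ k b y = cong (_ +_) (degIn-shift v s y)
  degIn-shift (_ ∷ v)        (false ∷ s) y = degIn-shift v s y

  hasEdgeIn-shift : ∀ {m} (v : Vec Edge m) s x y →
                    hasEdgeIn (Vec.map (shift k) v) s (k + x) (k + y) ≡ hasEdgeIn v s x y
  hasEdgeIn-shift []            []          x y = refl
  hasEdgeIn-shift ((a , b) ∷ v) (true ∷ s)  x y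
    rewrite ≡ᵇ-+ k a x | ≡ᵇ-+ k b y | ≡ᵇ-+ k a y | ≡ᵇ-+ k b x =
    cong (λ h → ((a ≡ᵇ x) ∧ (b ≡ᵇ y)) ∨ ((a ≡ᵇ y) ∧ (b ≡ᵇ x)) ∨ h) (hasEdgeIn-shift v s x y)
  hasEdgeIn-shift (_ ∷ v)       (false ∷ s) x y = hasEdgeIn-shift v s x y

  degIn-shift-below : ∀ {m} (v : Vec Edge m) s x → x < k → degIn (Vec.map (shift k) v) s x ≡ 0
  degIn-shift-below []            []          x x<k = refl
  degIn-shift-below ((a , b) ∷ v) (true ∷ s)  x x<k
    rewrite ≡ᵇ-false-< {k + a} (<-≤-trans x<k (m≤m+n k a)) | ≡ᵇ-false-< {k + b} (<-≤-trans x<k (m≤m+n k b)) =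
    degIn-shift-below v s x x<k
  degIn-shift-below (_ ∷ v)       (false ∷ s) x x<k = degIn-shift-below v s x x<k

  hasEdgeIn-shift-below : ∀ {m} (v : Vec Edge m) s x y → y < k → hasEdgeIn (Vec.map (shift k) v) s x y ≡ false
  hasEdgeIn-shift-below []            []          x y y<k = refl
  hasEdgeIn-shift-below ((a , b) ∷ v) (true ∷ s)  x y y<k
    rewrite ≡ᵇ-false-< {k + a} (<-≤-trans y<k (m≤m+n k a)) | ≡ᵇ-false-< {k + b} (<-≤-trans y<k (m≤m+n k b))
          | ∧-zeroʳ (k + a ≡ᵇ x) = hasEdgeIn-shift-below v s x y y<k
  hasEdgeIn-shift-below (_ ∷ v)       (false ∷ s) x y y<k = hasEdgeIn-shift-below v s x y y<k

Below : ℕ → Edge → Set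
Below B (a , b) = a < B × b < B

below-nonincident : ∀ {B x} e → Below B e → B ≤ x → T (not (incident x e))
below-nonincident {x = x} (a , b) (a<B , b<B) B≤x
  rewrite ≡ᵇ-false {a} {x} (λ a≡x → <-irrefl a≡x (<-≤-trans a<B B≤x))
        | ≡ᵇ-false {b} {x} (λ b≡x → <-irrefl b≡x (<-≤-trans b<B B≤x)) = _

private
  Below? : ∀ B e → Dec (Below B e)
  Below? B (a , b) = a <? B ×-dec b <? B

  shift-below : ∀ n {y} → y < 12 → 8 * n + y < 8 * suc n + 4
  shift-below n {y} y<12 = subst (8 * n + y <_) bound (+-monoʳ-< (8 * n) y<12)
    where
    bound : 8 * n + 12 ≡ 8 * suc n + 4
    bound = sym (trans (cong (_+ 4) (trans (*-suc 8 n) (+-comm 8 (8 * n)))) (+-assoc (8 * n) 8 4))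

  block-below : ∀ {es} → All (Below 12) es → ∀ n → All (Below (8 * suc n + 4)) (map (shift (8 * n)) es)
  block-below below n = All.map⁺ (All.map (λ (a<12 , b<12) → shift-below n a<12 , shift-below n b<12) below)

  bound-≤ : ∀ n → 8 * n + 4 ≤ 8 * suc n + 4
  bound-≤ n = +-monoˡ-≤ 4 (*-monoʳ-≤ 8 (n≤1+n n))

edges-below : ∀ n → All (Below (8 * n + 4)) (edgeList (Gn n))
edges-below zero    = from-yes (All.all? (Below? 4) (edgeList (Gn 0)))
edges-below (suc n) = subst (λ G → All (Below (8 * suc n + 4)) (edgeList G)) (sym (Gn-suc n))
  (All.++⁺ (All.++⁺ (weaken old-columns) (block-below (from-yes (All.all? (Below? 12) blockColumns)) n))
           (All.++⁺ (All.++⁺ (weaken old-rungs) (block-below (from-yes (All.all? (Below? 12) blockRungs)) n))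
                    (All.++⁺ (weaken old-caps) (block-below (from-yes (All.all? (Below? 12) blockCaps)) n))))
  where
  old = edges-below n
  old-columns = All.++⁻ˡ (columns n) old
  old-rungs = All.++⁻ˡ (rungs n) (All.++⁻ʳ (columns n) old)
  old-caps = All.++⁻ʳ (rungs n) (All.++⁻ʳ (columns n) old)
  weaken : ∀ {es} → All (Below (8 * n + 4)) es → All (Below (8 * suc n + 4)) es
  weaken = All.map λ (a<B , b<B) → <-≤-trans a<B (bound-≤ n) , <-≤-trans b<B (bound-≤ n)

vertices-below : ∀ n → All (_< 8 * n + 4) (verts (Gn n))
vertices-below zero    = from-yes (All.all? (_<? 4) (verts (Gn 0)))
vertices-below (suc n) = subst (All (_< 8 * suc n + 4)) (sym (vertices-suc n))
  (All.++⁺ (All.map (λ x<B → <-≤-trans x<B (bound-≤ n)) (vertices-below n))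
           (All.map⁺ (All.map (shift-below n) (from-yes (All.all? (_<? 12) blockVertices)))))

-- The block

boundaryDegree : ℕ → Bool → Bool → ℕ → ℕ
boundaryDegree k su sv x = (if su ∧ (x ≡ᵇ k) then 1 else 0) + (if sv ∧ (x ≡ᵇ suc k) then 1 else 0)

-- M together with a pendant edge at k (if su) and one at k + 1 (if sv) covers every vertex exactly once.
isBoundaryMatching : (G : Graph) → ℕ → Bool → Bool → EdgeSet G → Bool
isBoundaryMatching G k su sv M = allᵇ (λ x → boundaryDegree k su sv x + degIn (edges G) M x ≡ᵇ 1) (verts G)

edgeSetOf : (G : Graph) → List Edge → EdgeSet G
edgeSetOf G es = Vec.map (λ (a , b) → any (λ (c , d) → (a ≡ᵇ c) ∧ (b ≡ᵇ d)) es) (edges G)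

-- In the coordinates of G₁ the first two block edges are u₀u₁ and v₀v₁, the only ones meeting u₀ and v₀.
usesU usesV : EdgeSet block → Bool
usesU (b ∷ _)     = b
usesV (_ ∷ b ∷ _) = b

isRungFree : EdgeSet block → Bool
isRungFree β = not (hasEdge block β (uV 1) (vV 1)) ∧ not (hasEdge block β (uV 2) (vV 2))

admissible : EdgeSet block → Bool
admissible β = isBoundaryMatching block (uV 2) false false β ∧ isRungFree β

data Shape : Set where
  allHorizontal topHorizontal bottomHorizontal allVertical : Shape

shapes : List Shape
shapes = allHorizontal ∷ topHorizontal ∷ bottomHorizontal ∷ allVertical ∷ []

matchingOf : Shape → EdgeSet block
matchingOf allHorizontal    = edgeSetOf block ((wV 1 , wV 2) ∷ (uV 1 , uV 2) ∷ (vV 1 , vV 2) ∷ (zV 1 , zV 2) ∷ [])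
matchingOf topHorizontal    = edgeSetOf block ((wV 1 , wV 2) ∷ (uV 1 , uV 2) ∷ (vV 1 , zV 1) ∷ (vV 2 , zV 2) ∷ [])
matchingOf bottomHorizontal = edgeSetOf block ((wV 1 , uV 1) ∷ (wV 2 , uV 2) ∷ (vV 1 , vV 2) ∷ (zV 1 , zV 2) ∷ [])
matchingOf allVertical      = edgeSetOf block ((wV 1 , uV 1) ∷ (vV 1 , zV 1) ∷ (wV 2 , uV 2) ∷ (vV 2 , zV 2) ∷ [])

antiForcingOf : Shape → EdgeSet block
antiForcingOf allHorizontal    = edgeSetOf block ((wV 1 , uV 1) ∷ (vV 1 , zV 1) ∷ (uV 2 , vV 2) ∷ [])
antiForcingOf topHorizontal    = edgeSetOf block ((wV 1 , uV 1) ∷ (zV 1 , zV 2) ∷ [])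
antiForcingOf bottomHorizontal = edgeSetOf block ((vV 1 , zV 1) ∷ (wV 1 , wV 2) ∷ [])
antiForcingOf allVertical      = edgeSetOf block ((wV 1 , wV 2) ∷ (zV 1 , zV 2) ∷ [])

freeMatchings : List (EdgeSet block)
freeMatchings = edgeSetOf block ((uV 1 , vV 1) ∷ (uV 2 , vV 2) ∷ (wV 1 , wV 2) ∷ (zV 1 , zV 2) ∷ [])
              ∷ map matchingOf shapes

blockMatchings : List (EdgeSet block)
blockMatchings = freeMatchings ++
  edgeSetOf block ((uV 0 , uV 1) ∷ (vV 0 , vV 1) ∷ (uV 2 , vV 2) ∷ (wV 1 , wV 2) ∷ (zV 1 , zV 2) ∷ []) ∷ []

blockMatchings-complete : filterᵇ (isBoundaryMatching block (uV 2) false false) (allSubsets 12) ≡ blockMatchings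
blockMatchings-complete = refl

∈-blockMatchings : ∀ {β} → T (isBoundaryMatching block (uV 2) false false β) → β ∈ blockMatchings
∈-blockMatchings {β} h =
  subst (β ∈_) blockMatchings-complete (∈-filter⁺ (T? ∘ isBoundaryMatching block (uV 2) false false) (∈-allSubsets β) h)

admissible-shapes : filterᵇ admissible (allSubsets 12) ≡ map matchingOf shapes
admissible-shapes = begin
  filterᵇ admissible (allSubsets 12)
    ≡⟨ filterᵇ-∧ (isBoundaryMatching block (uV 2) false false) isRungFree (allSubsets 12) ⟩
  filterᵇ isRungFree (filterᵇ (isBoundaryMatching block (uV 2) false false) (allSubsets 12))
    ≡⟨ cong (filterᵇ isRungFree) blockMatchings-complete ⟩
  filterᵇ isRungFree blockMatchings
    ≡⟨⟩
  map matchingOf shapes ∎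

∈-shapes : ∀ s → s ∈ shapes
∈-shapes allHorizontal    = here refl
∈-shapes topHorizontal    = there (here refl)
∈-shapes bottomHorizontal = there (there (here refl))
∈-shapes allVertical      = there (there (there (here refl)))

forEachShape : (P : Shape → Bool) → allᵇ P shapes ≡ true → ∀ s → T (P s)
forEachShape P h s = allᵇ-lookup P shapes (≡true⇒T h) (∈-shapes s)

blockDegree-boundary : ∀ β y → y < 4 → degIn (edges block) β y ≡ boundaryDegree 0 (usesU β) (usesV β) y
blockDegree-boundary β y y<4 =
  ≡ᵇ⇒≡ _ _ (allᵇ-lookup (agrees β) (upTo 4) (allᵇ-allSubsets⁻ (λ β → allᵇ (agrees β) (upTo 4)) check β)
                        (∈-upTo⁺ y<4))
  where
  agrees : EdgeSet block → ℕ → Bool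
  agrees β y = degIn (edges block) β y ≡ᵇ boundaryDegree 0 (usesU β) (usesV β) y
  check : allᵇ (λ β → allᵇ (agrees β) (upTo 4)) (allSubsets 12) ≡ true
  check = refl

block-u₀v₀ : ∀ β → hasEdge block β (uV 0) (vV 0) ≡ false
block-u₀v₀ β = Equivalence.to T-not-≡ (allᵇ-allSubsets⁻ (λ β → not (hasEdge block β (uV 0) (vV 0))) check β)
  where
  check : allᵇ (λ β → not (hasEdge block β (uV 0) (vV 0))) (allSubsets 12) ≡ true
  check = refl

-- G_n − u_{2n} and G_n − v_{2n} have an odd number of vertices; inductively this is seen one block at a time.
private
  odd-boundary : ∀ b ρ → T (not (isBoundaryMatching block (uV 2) true false (b ∷ b ∷ ρ)
                                 ∨ isBoundaryMatching block (uV 2) false true (b ∷ b ∷ ρ)))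
  odd-boundary b ρ = allᵇ-lookup (excluded ρ) (true ∷ false ∷ [])
    (allᵇ-allSubsets⁻ (λ ρ → allᵇ (excluded ρ) (true ∷ false ∷ [])) check ρ) (∈-bools b)
    where
    excluded : Vec Bool 10 → Bool → Bool
    excluded ρ b = not (isBoundaryMatching block (uV 2) true false (b ∷ b ∷ ρ) ∨ isBoundaryMatching block (uV 2) false true (b ∷ b ∷ ρ))
    check : allᵇ (λ ρ → allᵇ (excluded ρ) (true ∷ false ∷ [])) (allSubsets 10) ≡ true
    check = refl
    ∈-bools : ∀ b → b ∈ true ∷ false ∷ []
    ∈-bools true  = here refl
    ∈-bools false = there (here refl)

block-parity : ∀ {su sv} β → T (isBoundaryMatching block (uV 2) su sv β) → usesU β ≡ usesV β → su ≡ sv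
block-parity {false} {false} _            _ _    = refl
block-parity {true}  {true}  _            _ _    = refl
block-parity {false} {true}  (b ∷ .b ∷ ρ) h refl = ⊥-elim (T-not⇒¬T (odd-boundary b ρ) (T-∨⁺ʳ h))
block-parity {true}  {false} (b ∷ .b ∷ ρ) h refl = ⊥-elim (T-not⇒¬T (odd-boundary b ρ) (T-∨⁺ˡ h))

shape-admissible : ∀ s → T (admissible (matchingOf s))
shape-admissible = forEachShape (λ s → admissible (matchingOf s)) refl

shape-usesU : ∀ s → usesU (matchingOf s) ≡ false
shape-usesU allHorizontal    = refl
shape-usesU topHorizontal    = refl
shape-usesU bottomHorizontal = refl
shape-usesU allVertical      = refl

shape-usesV : ∀ s → usesV (matchingOf s) ≡ false
shape-usesV allHorizontal    = refl
shape-usesV topHorizontal    = refl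
shape-usesV bottomHorizontal = refl
shape-usesV allVertical      = refl

antiForcingOf-avoids : ∀ s → T (antiForcingOf s ⊆ᵇ compl (matchingOf s))
antiForcingOf-avoids = forEachShape (λ s → antiForcingOf s ⊆ᵇ compl (matchingOf s)) refl

shape-unique : ∀ s β′ → T (isBoundaryMatching block (uV 2) false false β′) → T (β′ ⊆ᵇ compl (antiForcingOf s)) →
               usesU β′ ≡ usesV β′ → β′ ≡ matchingOf s
shape-unique s β′ matches avoids same =
  ==ᵇ⇒≡ {s = β′} (balanced (usesU β′) (usesV β′) {β′ ==ᵇ matchingOf s} same (⇒ᵇ-elim unique-β′ avoids))
  where
  unique : Shape → EdgeSet block → Bool
  unique s β′ = (β′ ⊆ᵇ compl (antiForcingOf s))
              ⇒ᵇ not (usesU β′ ∧ usesV β′) ∧ (usesU β′ ∨ usesV β′ ∨ (β′ ==ᵇ matchingOf s))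
  check : allᵇ (λ s → allᵇ (unique s) blockMatchings) shapes ≡ true
  check = refl
  unique-β′ : T (unique s β′)
  unique-β′ = allᵇ-lookup (unique s) blockMatchings (forEachShape (λ s → allᵇ (unique s) blockMatchings) check s)
                          (∈-blockMatchings {β′} matches)
  balanced : ∀ u v {e} → u ≡ v → T (not (u ∧ v) ∧ (u ∨ v ∨ e)) → T e
  balanced false .false refl h = h

shape-lower : ∀ s τ → T (τ ⊆ᵇ compl (matchingOf s)) →
  (∀ β′ → T (isBoundaryMatching block (uV 2) false false β′) → usesU β′ ≡ false → usesV β′ ≡ false →
          T (β′ ⊆ᵇ compl τ) → β′ ≡ matchingOf s) →
  size (antiForcingOf s) ≤ size τ
shape-lower s τ avoids forces =
  ≤ᵇ⇒≤ _ _ (⇒ᵇ-elim (⇒ᵇ-elim lower-τ avoids) forces-free)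
  where
  lower : Shape → EdgeSet block → Bool
  lower s τ = (τ ⊆ᵇ compl (matchingOf s))
            ⇒ᵇ allᵇ (λ β′ → (β′ ⊆ᵇ compl τ) ⇒ᵇ (β′ ==ᵇ matchingOf s)) freeMatchings
            ⇒ᵇ (size (antiForcingOf s) ≤ᵇ size τ)
  check : allᵇ (λ s → allᵇ (lower s) (allSubsets 12)) shapes ≡ true
  check = refl
  lower-τ : T (lower s τ)
  lower-τ = allᵇ-lookup (lower s) (allSubsets 12) (forEachShape (λ s → allᵇ (lower s) (allSubsets 12)) check s)
                        (∈-allSubsets τ)
  free : ∀ {β′} → β′ ∈ freeMatchings →
         T (isBoundaryMatching block (uV 2) false false β′) × usesU β′ ≡ false × usesV β′ ≡ false
  free (here refl)                                 = _ , refl , refl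
  free (there (here refl))                         = _ , refl , refl
  free (there (there (here refl)))                 = _ , refl , refl
  free (there (there (there (here refl))))         = _ , refl , refl
  free (there (there (there (there (here refl))))) = _ , refl , refl
  forces-free : T (allᵇ (λ β′ → (β′ ⊆ᵇ compl τ) ⇒ᵇ (β′ ==ᵇ matchingOf s)) freeMatchings)
  forces-free = allᵇ⁺ (All.tabulate λ {β′} β′∈ → ⇒ᵇ-intro λ β′⊆ →
    let matches , u , v = free β′∈
    in subst (λ β → T (β′ ==ᵇ β)) (forces β′ matches u v β′⊆) (==ᵇ-refl β′))

admissible⇒shape : ∀ β → T (admissible β) → Σ Shape λ s → β ≡ matchingOf s
admissible⇒shape β h = proj₁ found , proj₂ (proj₂ found)
  where
  β∈ : β ∈ map matchingOf shapes
  β∈ = subst (β ∈_) admissible-shapes (∈-filter⁺ (T? ∘ admissible) {x = β} (∈-allSubsets β) h)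
  found = ∈-map⁻ matchingOf {xs = shapes} β∈

-- Decomposing G_{n+1} into G_n and the block

boundaryDegree-below : ∀ {k x} su sv → x < k → boundaryDegree k su sv x ≡ 0
boundaryDegree-below {k} {x} su sv x<k
  rewrite ≡ᵇ-false {x} {k} (<⇒≢ x<k) | ≡ᵇ-false {x} {suc k} (<⇒≢ (m<n⇒m<1+n x<k))
        | ∧-zeroʳ su | ∧-zeroʳ sv = refl

boundaryDegree-+ : ∀ k m su sv y → boundaryDegree (k + m) su sv (k + y) ≡ boundaryDegree m su sv y
boundaryDegree-+ k m su sv y rewrite sym (+-suc k m) | ≡ᵇ-+ k y m | ≡ᵇ-+ k y (suc m) = refl

-- inM0 n is isM0 (Gn n) (2 * n); stating it for any graph lets it be transported along Gn-suc.
isM0 : (G : Graph) → ℕ → EdgeSet G → Bool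
isM0 G m M = isPerfectMatching G M ∧ hasEdge G M (uV 0) (vV 0) ∧ allᵇ (λ j → not (hasEdge G M (uV j) (vV j))) (oneTo m)

module _ (n : ℕ) where

  open Glued n

  private
    k = 8 * n

    8*suc : 8 * suc n ≡ k + 8
    8*suc = trans (*-suc 8 n) (+-comm 8 k)

  shiftedBlock : Vec Edge 12
  shiftedBlock = Vec.map (shift k) (edges block)

  degIn-weave : ∀ M β x → degIn (edges (glued n)) (weave M β) x ≡ degIn (edges (Gn n)) M x + degIn shiftedBlock β x
  degIn-weave M β x =
    weave-hom _+_ (interchange +-commutativeSemigroup) (λ zs u → degIn (fromList zs) u x)
              (λ zs ws u w → degIn-join zs ws u w x) M β

  hasEdge-weave : ∀ M β x y → hasEdge (glued n) (weave M β) x y ≡ hasEdge (Gn n) M x y ∨ hasEdgeIn shiftedBlock β x y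
  hasEdge-weave M β x y =
    weave-hom _∨_ (interchange (CommutativeMonoid.commutativeSemigroup ∨-commutativeMonoid))
              (λ zs u → hasEdgeIn (fromList zs) u x y) (λ zs ws u w → hasEdgeIn-join zs ws u w x y) M β

  size-weave : ∀ M β → size (weave M β) ≡ size M + size β
  size-weave = weave-hom _+_ (interchange +-commutativeSemigroup) (λ _ u → size u) size-join

  ⊆ᵇ-weave : ∀ M β M′ β′ → (weave M β ⊆ᵇ weave M′ β′) ≡ (M ⊆ᵇ M′) ∧ (β ⊆ᵇ β′)
  ⊆ᵇ-weave M β M′ β′ =
    weave-hom₂ _∧_ (interchange (CommutativeMonoid.commutativeSemigroup ∧-commutativeMonoid)) (λ _ u u′ → u ⊆ᵇ u′)
               ⊆ᵇ-join M β M′ β′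

  private
    shiftedDegree-boundary : ∀ β y → y < 4 → degIn shiftedBlock β (k + y) ≡ boundaryDegree k (usesU β) (usesV β) (k + y)
    shiftedDegree-boundary β y y<4 = begin
      degIn shiftedBlock β (k + y)                          ≡⟨ degIn-shift k (edges block) β y ⟩
      degIn (edges block) β y                               ≡⟨ blockDegree-boundary β y y<4 ⟩
      boundaryDegree 0 (usesU β) (usesV β) y                ≡⟨ boundaryDegree-+ k 0 (usesU β) (usesV β) y ⟨
      boundaryDegree (k + 0) (usesU β) (usesV β) (k + y)
        ≡⟨ cong (λ c → boundaryDegree c (usesU β) (usesV β) (k + y)) (+-identityʳ k) ⟩
      boundaryDegree k (usesU β) (usesV β) (k + y)          ∎

  shiftedDegree-old : ∀ β x → x < k + 4 → degIn shiftedBlock β x ≡ boundaryDegree k (usesU β) (usesV β) x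
  shiftedDegree-old β x x<k+4 with x <? k
  ... | yes x<k = trans (degIn-shift-below k (edges block) β x x<k) (sym (boundaryDegree-below (usesU β) (usesV β) x<k))
  ... | no x≮k  = subst (λ z → degIn shiftedBlock β z ≡ boundaryDegree k (usesU β) (usesV β) z) k+[x∸k]≡x
                    (shiftedDegree-boundary β (x ∸ k) (+-cancelˡ-< k (x ∸ k) 4 (subst (_< k + 4) (sym k+[x∸k]≡x) x<k+4)))
    where
    k+[x∸k]≡x : k + (x ∸ k) ≡ x
    k+[x∸k]≡x = m+[n∸m]≡n (≮⇒≥ x≮k)

  oldEdges-nonincident : ∀ {x} → k + 4 ≤ x → All (λ e → T (not (incident x e))) (edgeList (Gn n))
  oldEdges-nonincident k+4≤x = All.map (λ {e} below → below-nonincident e below k+4≤x) (edges-below n)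

  degree-new : ∀ M β y → 4 ≤ y → degIn (edges (glued n)) (weave M β) (k + y) ≡ degIn (edges block) β y
  degree-new M β y 4≤y = begin
    degIn (edges (glued n)) (weave M β) (k + y)                ≡⟨ degIn-weave M β (k + y) ⟩
    degIn (edges (Gn n)) M (k + y) + degIn shiftedBlock β (k + y)
      ≡⟨ cong₂ _+_ (degIn-nonincident (edgeList (Gn n)) M (k + y) (oldEdges-nonincident (+-monoʳ-≤ k 4≤y)))
                   (degIn-shift k (edges block) β y) ⟩
    degIn (edges block) β y                                     ∎

  degree-old : ∀ su sv M β x → x < k + 4 →
    boundaryDegree (8 * suc n) su sv x + degIn (edges (glued n)) (weave M β) x
      ≡ boundaryDegree k (usesU β) (usesV β) x + degIn (edges (Gn n)) M x
  degree-old su sv M β x x<k+4 = begin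
    boundaryDegree (8 * suc n) su sv x + degIn (edges (glued n)) (weave M β) x
      ≡⟨ cong₂ _+_ (boundaryDegree-below su sv (<-≤-trans x<k+4 k+4≤8*suc)) (degIn-weave M β x) ⟩
    degIn (edges (Gn n)) M x + degIn shiftedBlock β x
      ≡⟨ cong (_ +_) (shiftedDegree-old β x x<k+4) ⟩
    degIn (edges (Gn n)) M x + boundaryDegree k (usesU β) (usesV β) x
      ≡⟨ +-comm (degIn (edges (Gn n)) M x) _ ⟩
    boundaryDegree k (usesU β) (usesV β) x + degIn (edges (Gn n)) M x ∎
    where
    k+4≤8*suc : k + 4 ≤ 8 * suc n
    k+4≤8*suc = subst (k + 4 ≤_) (sym 8*suc) (+-monoʳ-≤ k (s≤s (s≤s (s≤s (s≤s z≤n)))))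

  isBoundaryMatching-weave : ∀ su sv M β →
    isBoundaryMatching (glued n) (8 * suc n) su sv (weave M β)
      ≡ isBoundaryMatching (Gn n) k (usesU β) (usesV β) M ∧ isBoundaryMatching block (uV 2) su sv β
  isBoundaryMatching-weave su sv M β = begin
    allᵇ covered (verts (Gn n) ++ map (k +_) blockVertices)
      ≡⟨ allᵇ-++ covered (verts (Gn n)) _ ⟩
    allᵇ covered (verts (Gn n)) ∧ allᵇ covered (map (k +_) blockVertices)
      ≡⟨ cong₂ _∧_ (allᵇ-cong (λ x<k+4 → cong (_≡ᵇ 1) (degree-old su sv M β _ x<k+4)) (vertices-below n))
                   (allᵇ-map covered (k +_) blockVertices) ⟩
    isBoundaryMatching (Gn n) k (usesU β) (usesV β) M ∧ allᵇ (covered ∘ (k +_)) blockVertices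
      ≡⟨ cong (isBoundaryMatching (Gn n) k (usesU β) (usesV β) M ∧_)
              (allᵇ-cong (λ {y} 4≤y → cong₂ (λ b d → b + d ≡ᵇ 1) (boundary-new y) (degree-new M β y 4≤y))
                                (from-yes (All.all? (4 ≤?_) blockVertices))) ⟩
    isBoundaryMatching (Gn n) k (usesU β) (usesV β) M ∧ isBoundaryMatching block (uV 2) su sv β ∎
    where
    covered : ℕ → Bool
    covered x = boundaryDegree (8 * suc n) su sv x + degIn (edges (glued n)) (weave M β) x ≡ᵇ 1
    boundary-new : ∀ y → boundaryDegree (8 * suc n) su sv (k + y) ≡ boundaryDegree 8 su sv y
    boundary-new y = trans (cong (λ c → boundaryDegree c su sv (k + y)) 8*suc) (boundaryDegree-+ k 8 su sv y)

  private
    4*2n≡k : 4 * (2 * n) ≡ k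
    4*2n≡k = sym (*-assoc 4 2 n)

    vV<uV-suc : ∀ j → vV j < uV (suc j)
    vV<uV-suc j = subst (vV j <_) (trans (+-comm (4 * j) 4) (sym (*-suc 4 j))) (+-monoʳ-< (4 * j) (s≤s (s≤s z≤n)))

  old-rung : ∀ β j → j ≤ 2 * n → hasEdgeIn shiftedBlock β (uV j) (vV j) ≡ false
  old-rung β j j≤2n with m≤n⇒m<n∨m≡n j≤2n
  ... | inj₁ j<2n = hasEdgeIn-shift-below k (edges block) β (uV j) (vV j)
                      (<-≤-trans (vV<uV-suc j) (subst (uV (suc j) ≤_) 4*2n≡k (*-monoʳ-≤ 4 j<2n)))
  ... | inj₂ refl = begin
    hasEdgeIn shiftedBlock β (uV (2 * n)) (vV (2 * n))
      ≡⟨ cong₂ (hasEdgeIn shiftedBlock β) (trans 4*2n≡k (sym (+-identityʳ k))) (cong (_+ 1) 4*2n≡k) ⟩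
    hasEdgeIn shiftedBlock β (k + 0) (k + 1)  ≡⟨ hasEdgeIn-shift k (edges block) β 0 1 ⟩
    hasEdge block β (uV 0) (vV 0)             ≡⟨ block-u₀v₀ β ⟩
    false                                     ∎

  hasEdge-old : ∀ M β j → j ≤ 2 * n → hasEdge (glued n) (weave M β) (uV j) (vV j) ≡ hasEdge (Gn n) M (uV j) (vV j)
  hasEdge-old M β j j≤2n =
    trans (hasEdge-weave M β (uV j) (vV j))
          (trans (cong (hasEdge (Gn n) M (uV j) (vV j) ∨_) (old-rung β j j≤2n)) (∨-identityʳ _))

  hasEdge-new : ∀ M β i → 1 ≤ i →
                hasEdge (glued n) (weave M β) (uV (2 * n + i)) (vV (2 * n + i)) ≡ hasEdge block β (uV i) (vV i)
  hasEdge-new M β i 1≤i = begin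
    hasEdge (glued n) (weave M β) (uV (2 * n + i)) (vV (2 * n + i))
      ≡⟨ hasEdge-weave M β _ _ ⟩
    hasEdge (Gn n) M (uV (2 * n + i)) (vV (2 * n + i)) ∨ hasEdgeIn shiftedBlock β (uV (2 * n + i)) (vV (2 * n + i))
      ≡⟨ cong₂ _∨_ (hasEdgeIn-nonincident (edgeList (Gn n)) M _ _ (oldEdges-nonincident k+4≤uV))
                   (cong₂ (hasEdgeIn shiftedBlock β) (uV-shift n i) (label-shift n i 1)) ⟩
    hasEdgeIn shiftedBlock β (k + uV i) (k + vV i)
      ≡⟨ hasEdgeIn-shift k (edges block) β (uV i) (vV i) ⟩
    hasEdge block β (uV i) (vV i) ∎
    where
    k+4≤uV : k + 4 ≤ uV (2 * n + i)
    k+4≤uV = subst (k + 4 ≤_) (sym (uV-shift n i)) (+-monoʳ-≤ k (*-monoʳ-≤ 4 1≤i))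

  rungFree-weave : ∀ M β →
    allᵇ (λ j → not (hasEdge (glued n) (weave M β) (uV j) (vV j))) (oneTo (2 * suc n))
      ≡ allᵇ (λ j → not (hasEdge (Gn n) M (uV j) (vV j))) (oneTo (2 * n)) ∧ isRungFree β
  rungFree-weave M β = begin
    allᵇ noRung (oneTo (2 * suc n))
      ≡⟨ cong (allᵇ noRung) (oneTo-2*suc n) ⟩
    allᵇ noRung (oneTo (2 * n) ++ (2 * n + 1 ∷ 2 * n + 2 ∷ []))
      ≡⟨ allᵇ-++ noRung (oneTo (2 * n)) _ ⟩
    allᵇ noRung (oneTo (2 * n)) ∧ (noRung (2 * n + 1) ∧ (noRung (2 * n + 2) ∧ true))
      ≡⟨ cong₂ _∧_ (allᵇ-cong (λ {j} j≤2n → cong not (hasEdge-old M β j j≤2n)) (oneTo-≤ (2 * n)))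
                   (cong₂ (λ a b → not a ∧ (not b ∧ true)) (hasEdge-new M β 1 (s≤s z≤n))
                                                             (hasEdge-new M β 2 (s≤s z≤n))) ⟩
    allᵇ (λ j → not (hasEdge (Gn n) M (uV j) (vV j))) (oneTo (2 * n))
      ∧ (not (hasEdge block β (uV 1) (vV 1)) ∧ (not (hasEdge block β (uV 2) (vV 2)) ∧ true))
      ≡⟨ cong (λ b → allᵇ (λ j → not (hasEdge (Gn n) M (uV j) (vV j))) (oneTo (2 * n))
                     ∧ (not (hasEdge block β (uV 1) (vV 1)) ∧ b))
              (∧-identityʳ (not (hasEdge block β (uV 2) (vV 2)))) ⟩
    allᵇ (λ j → not (hasEdge (Gn n) M (uV j) (vV j))) (oneTo (2 * n)) ∧ isRungFree β ∎
    where
    noRung : ℕ → Bool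
    noRung j = not (hasEdge (glued n) (weave M β) (uV j) (vV j))

  isM0-weave : ∀ M β → isM0 (glued n) (2 * suc n) (weave M β) ≡ isM0 (Gn n) (2 * n) M ∧ admissible β
  isM0-weave M β = begin
    isM0 (glued n) (2 * suc n) (weave M β)
      ≡⟨ cong₂ _∧_ (isBoundaryMatching-weave false false M β) (cong₂ _∧_ (hasEdge-old M β 0 z≤n) (rungFree-weave M β)) ⟩
    (isBoundaryMatching (Gn n) k (usesU β) (usesV β) M ∧ isBoundaryMatching block (uV 2) false false β)
      ∧ (hasEdge (Gn n) M (uV 0) (vV 0) ∧ (rungFree ∧ isRungFree β))
      ≡⟨ shuffle (isBoundaryMatching (Gn n) k (usesU β) (usesV β) M) (isBoundaryMatching block (uV 2) false false β)
                 (hasEdge (Gn n) M (uV 0) (vV 0)) rungFree (isRungFree β) ⟩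
    (isBoundaryMatching (Gn n) k (usesU β) (usesV β) M ∧ (hasEdge (Gn n) M (uV 0) (vV 0) ∧ rungFree)) ∧ admissible β
      ≡⟨ unused-boundary (hasEdge (Gn n) M (uV 0) (vV 0) ∧ rungFree) ⟩
    isM0 (Gn n) (2 * n) M ∧ admissible β ∎
    where
    rungFree = allᵇ (λ j → not (hasEdge (Gn n) M (uV j) (vV j))) (oneTo (2 * n))
    shuffle : ∀ a b c d e → (a ∧ b) ∧ (c ∧ (d ∧ e)) ≡ (a ∧ (c ∧ d)) ∧ (b ∧ e)
    shuffle false b     c d e = refl
    shuffle true  true  c d e = sym (∧-assoc c d e)
    shuffle true  false c d e = sym (∧-zeroʳ (c ∧ d))
    unused-boundary : ∀ X → (isBoundaryMatching (Gn n) k (usesU β) (usesV β) M ∧ X) ∧ admissible β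
                             ≡ (isPerfectMatching (Gn n) M ∧ X) ∧ admissible β
    unused-boundary X with admissible β in adm
    ... | false = trans (∧-zeroʳ (isBoundaryMatching (Gn n) k (usesU β) (usesV β) M ∧ X))
                        (sym (∧-zeroʳ (isPerfectMatching (Gn n) M ∧ X)))
    ... | true  = cong (λ (u , v) → (isBoundaryMatching (Gn n) k u v M ∧ X) ∧ true)
                       (cong₂ _,_ (trans (cong usesU β≡) (shape-usesU s)) (trans (cong usesV β≡) (shape-usesV s)))
      where
      s = proj₁ (admissible⇒shape β (≡true⇒T adm))
      β≡ = proj₂ (admissible⇒shape β (≡true⇒T adm))

-- Additivity of the anti-forcing number

parity : ∀ n {su sv} M → T (isBoundaryMatching (Gn n) (8 * n) su sv M) → su ≡ sv
parity zero {false} {false} _ _ = refl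
parity zero {true}  {true}  _ _ = refl
parity zero {false} {true}  (true ∷ [])  ()
parity zero {false} {true}  (false ∷ []) ()
parity zero {true}  {false} (true ∷ [])  ()
parity zero {true}  {false} (false ∷ []) ()
parity (suc n) {su} {sv} =
  subst (λ G → ∀ M → T (isBoundaryMatching G (8 * suc n) su sv M) → su ≡ sv) (sym (Gn-suc n))
    (Glued.weave-elim n _ λ M β h →
      let hM , hβ = T-∧⁻ {isBoundaryMatching (Gn n) (8 * n) (usesU β) (usesV β) M}
                           (subst T (isBoundaryMatching-weave n su sv M β) h)
      in block-parity β hβ (parity n M hM))

module _ (n : ℕ) where

  open Glued n

  private
    k = 8 * n

  ⊆ᵇ-compl-weave : ∀ S τ M β → (weave S τ ⊆ᵇ compl (weave M β)) ≡ (S ⊆ᵇ compl M) ∧ (τ ⊆ᵇ compl β)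
  ⊆ᵇ-compl-weave S τ M β = trans (cong (weave S τ ⊆ᵇ_) (compl-weave M β)) (⊆ᵇ-weave n S τ (compl M) (compl β))

  perfect-weave⁺ : ∀ M β → T (isPerfectMatching (Gn n) M) → T (isBoundaryMatching block (uV 2) false false β) →
                  usesU β ≡ false → usesV β ≡ false → T (isPerfectMatching (glued n) (weave M β))
  perfect-weave⁺ M β M-perfect β-matches u v =
    subst T (sym (isBoundaryMatching-weave n false false M β))
      (T-∧⁺ {isBoundaryMatching (Gn n) k (usesU β) (usesV β) M}
               (subst₂ (λ u v → T (isBoundaryMatching (Gn n) k u v M)) (sym u) (sym v) M-perfect) β-matches)

  perfect-weave⁻ : ∀ M β → T (isPerfectMatching (glued n) (weave M β)) →
                   T (isBoundaryMatching (Gn n) k (usesU β) (usesV β) M) × T (isBoundaryMatching block (uV 2) false false β)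
  perfect-weave⁻ M β h =
    T-∧⁻ {isBoundaryMatching (Gn n) k (usesU β) (usesV β) M} (subst T (isBoundaryMatching-weave n false false M β) h)

  glued-optimal : ∀ {M S} s → Optimal (Gn n) M S →
                  Optimal (glued n) (weave M (matchingOf s)) (weave S (antiForcingOf s))
  glued-optimal {M} {S} s opt = record
    { antiForcing = record { avoids = avoids ; perfect = perfect ; unique = unique }
    ; minimal     = minimal
    }
    where
    open Optimal opt using () renaming (antiForcing to S-antiForcing; minimal to S-minimal)
    open AntiForcing S-antiForcing using () renaming (avoids to S-avoids; perfect to M-perfect; unique to S-unique)
    B = matchingOf s
    B-matches : T (isBoundaryMatching block (uV 2) false false B)
    B-matches = proj₁ (T-∧⁻ {isBoundaryMatching block (uV 2) false false B} (shape-admissible s))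

    perfect : T (isPerfectMatching (glued n) (weave M B))
    perfect = perfect-weave⁺ M B M-perfect B-matches (shape-usesU s) (shape-usesV s)

    avoids : T (weave S (antiForcingOf s) ⊆ᵇ compl (weave M B))
    avoids = subst T (sym (⊆ᵇ-compl-weave S (antiForcingOf s) M B))
                   (T-∧⁺ {S ⊆ᵇ compl M} S-avoids (antiForcingOf-avoids s))

    unique : ∀ M′ → T (M′ ⊆ᵇ compl (weave S (antiForcingOf s))) → T (isPerfectMatching (glued n) M′) → M′ ≡ weave M B
    unique = weave-elim _ λ M′ β′ M′⊆ M′-perfect →
      let M′⊆S , β′⊆ = T-∧⁻ {M′ ⊆ᵇ compl S} (subst T (⊆ᵇ-compl-weave M′ β′ S (antiForcingOf s)) M′⊆)
          M′-matches , β′-matches = perfect-weave⁻ M′ β′ M′-perfect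
          β′≡m = shape-unique s β′ β′-matches β′⊆ (parity n M′ M′-matches)
          M′-perfect₀ = subst₂ (λ u v → T (isBoundaryMatching (Gn n) k u v M′))
                          (trans (cong usesU β′≡m) (shape-usesU s)) (trans (cong usesV β′≡m) (shape-usesV s)) M′-matches
      in cong₂ weave (S-unique M′ M′⊆S M′-perfect₀) β′≡m

    minimal : ∀ S′ → AntiForcing (glued n) (weave M B) S′ → size (weave S (antiForcingOf s)) ≤ size S′
    minimal = weave-elim _ λ R τ S′-antiForcing →
      let open AntiForcing S′-antiForcing using () renaming (avoids to S′-avoids; unique to S′-unique)
          R⊆ , τ⊆ = T-∧⁻ {R ⊆ᵇ compl M} (subst T (⊆ᵇ-compl-weave R τ M B) S′-avoids)
          forced : ∀ N β → T (N ⊆ᵇ compl R) → T (β ⊆ᵇ compl τ) → T (isPerfectMatching (glued n) (weave N β)) →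
                   N ≡ M × β ≡ B
          forced N β N⊆ β⊆ N-perfect = weave-injective
            (S′-unique (weave N β) (subst T (sym (⊆ᵇ-compl-weave N β R τ)) (T-∧⁺ {N ⊆ᵇ compl R} N⊆ β⊆)) N-perfect)
          R-antiForcing : AntiForcing (Gn n) M R
          R-antiForcing = record
            { avoids  = R⊆
            ; perfect = M-perfect
            ; unique  = λ N N⊆ N-perfect → proj₁ (forced N B N⊆ (subst T (⊆ᵇ-compl-comm τ B) τ⊆)
                          (perfect-weave⁺ N B N-perfect B-matches (shape-usesU s) (shape-usesV s)))
            }
          τ-bound = shape-lower s τ τ⊆ λ β′ β′-matches u v β′⊆ →
                      proj₂ (forced M β′ (subst T (⊆ᵇ-compl-comm R M) R⊆) β′⊆
                                    (perfect-weave⁺ M β′ M-perfect β′-matches u v))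
      in subst₂ _≤_ (sym (size-weave n S (antiForcingOf s))) (sym (size-weave n R τ))
                (+-mono-≤ (S-minimal R R-antiForcing) τ-bound)

optimal-exists : ∀ n M → T (inM0 n M) → Σ (EdgeSet (Gn n)) (Optimal (Gn n) M)
optimal-exists zero (true ∷ []) _ = false ∷ [] , record
  { antiForcing = record { avoids = _ ; perfect = _ ; unique = unique }
  ; minimal     = λ _ _ → z≤n
  }
  where
  unique : ∀ M′ → T (M′ ⊆ᵇ compl (false ∷ [])) → T (isPerfectMatching (Gn 0) M′) → M′ ≡ true ∷ []
  unique (true ∷ []) _ _ = refl
optimal-exists (suc n) =
  subst (λ G → ∀ M → T (isM0 G (2 * suc n) M) → Σ (EdgeSet G) (Optimal G M)) (sym (Gn-suc n))
    (Glued.weave-elim n _ λ M β h →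
      let M-in , β-admissible = T-∧⁻ {isM0 (Gn n) (2 * n) M} (subst T (isM0-weave n M β) h)
          s , β≡ = admissible⇒shape β β-admissible
          S , S-optimal = optimal-exists n M M-in
      in Glued.weave n S (antiForcingOf s)
         , subst (λ β → Optimal (glued n) (Glued.weave n M β) (Glued.weave n S (antiForcingOf s))) (sym β≡)
                 (glued-optimal n s S-optimal))

af-weave : ∀ n M s → T (inM0 n M) →
           af (glued n) (Glued.weave n M (matchingOf s)) ≡ af (Gn n) M + size (antiForcingOf s)
af-weave n M s M-in =
  trans (af-optimal (glued-optimal n s S-optimal))
        (trans (size-weave n S (antiForcingOf s)) (cong (_+ size (antiForcingOf s)) (sym (af-optimal S-optimal))))
  where
  S = proj₁ (optimal-exists n M M-in)
  S-optimal = proj₂ (optimal-exists n M M-in)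

-- The generating function

weight : (G : Graph) → ℕ → ℕ → EdgeSet G → ℕ
weight G m x M = if isM0 G m M then x ^ af G M else 0

afPoly-weight : ∀ n x → afPoly n x ≡ sumSubsets (nE (Gn n)) (weight (Gn n) (2 * n) x)
afPoly-weight n x = sumSubsets-filterᵇ (inM0 n) (λ M → x ^ af (Gn n) M)

sumSubsets-admissible : (f : EdgeSet block → ℕ) →
  sumSubsets 12 (λ β → if admissible β then f β else 0) ≡ sum (map (f ∘ matchingOf) shapes)
sumSubsets-admissible f = begin
  sumSubsets 12 (λ β → if admissible β then f β else 0)  ≡⟨ sumSubsets-filterᵇ admissible f ⟨
  sum (map f (filterᵇ admissible (allSubsets 12)))        ≡⟨ cong (sum ∘ map f) admissible-shapes ⟩
  sum (map (f ∘ matchingOf) shapes)                       ∎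

module _ (n x : ℕ) where

  open Glued n

  shapePolynomial : sum (map (λ s → x ^ size (antiForcingOf s)) shapes) ≡ x ^ 3 + 3 * x ^ 2
  shapePolynomial = refl

  admissibleSum : ∀ M → T (inM0 n M) →
    sumSubsets 12 (λ β → if admissible β then x ^ af (glued n) (weave M β) else 0) ≡ x ^ af (Gn n) M * (x ^ 3 + 3 * x ^ 2)
  admissibleSum M M-in = begin
    sumSubsets 12 (λ β → if admissible β then x ^ af (glued n) (weave M β) else 0)
      ≡⟨ sumSubsets-admissible (λ β → x ^ af (glued n) (weave M β)) ⟩
    sum (map (λ s → x ^ af (glued n) (weave M (matchingOf s))) shapes)
      ≡⟨ cong sum (map-cong (λ s → trans (cong (x ^_) (af-weave n M s M-in))
                                         (^-distribˡ-+-* x (af (Gn n) M) (size (antiForcingOf s)))) shapes) ⟩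
    sum (map (λ s → x ^ af (Gn n) M * x ^ size (antiForcingOf s)) shapes)
      ≡⟨ sum-map-*ˡ (x ^ af (Gn n) M) (λ s → x ^ size (antiForcingOf s)) shapes ⟩
    x ^ af (Gn n) M * sum (map (λ s → x ^ size (antiForcingOf s)) shapes)
      ≡⟨ cong (x ^ af (Gn n) M *_) shapePolynomial ⟩
    x ^ af (Gn n) M * (x ^ 3 + 3 * x ^ 2) ∎

  weight-weave : ∀ M → ∑[ β ⊆ Y ] weight (glued n) (2 * suc n) x (weave M β)
                       ≡ weight (Gn n) (2 * n) x M * (x ^ 3 + 3 * x ^ 2)
  weight-weave M = begin
    ∑[ β ⊆ Y ] weight (glued n) (2 * suc n) x (weave M β)
      ≡⟨ sumSubsets-cong (λ β → cong (λ b → if b then x ^ af (glued n) (weave M β) else 0) (isM0-weave n M β)) ⟩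
    sumSubsets 12 (λ β → if inM0 n M ∧ admissible β then x ^ af (glued n) (weave M β) else 0)
      ≡⟨ sumSubsets-guard (inM0 n M) admissible (λ β → x ^ af (glued n) (weave M β)) (admissibleSum M) ⟩
    (if inM0 n M then x ^ af (Gn n) M * (x ^ 3 + 3 * x ^ 2) else 0)
      ≡⟨ if-* (inM0 n M) ⟨
    weight (Gn n) (2 * n) x M * (x ^ 3 + 3 * x ^ 2) ∎
    where
    if-* : ∀ b → (if b then x ^ af (Gn n) M else 0) * (x ^ 3 + 3 * x ^ 2)
                 ≡ (if b then x ^ af (Gn n) M * (x ^ 3 + 3 * x ^ 2) else 0)
    if-* false = refl
    if-* true  = refl

  afPoly-suc : afPoly (suc n) x ≡ afPoly n x * (x ^ 3 + 3 * x ^ 2)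
  afPoly-suc = begin
    afPoly (suc n) x
      ≡⟨ afPoly-weight (suc n) x ⟩
    sumSubsets (nE (Gn (suc n))) (weight (Gn (suc n)) (2 * suc n) x)
      ≡⟨ cong (λ G → sumSubsets (nE G) (weight G (2 * suc n) x)) (Gn-suc n) ⟩
    sumSubsets (nE (glued n)) (weight (glued n) (2 * suc n) x)
      ≡⟨ sumOver-weave (weight (glued n) (2 * suc n) x) ⟩
    ∑[ M ⊆ X ] ∑[ β ⊆ Y ] weight (glued n) (2 * suc n) x (weave M β)
      ≡⟨ sumSubsets-cong weight-weave ⟩
    ∑[ M ⊆ X ] (weight (Gn n) (2 * n) x M * (x ^ 3 + 3 * x ^ 2))
      ≡⟨ sumSubsets-*ʳ (x ^ 3 + 3 * x ^ 2) (weight (Gn n) (2 * n) x) ⟩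
    sumSubsets (nE (Gn n)) (weight (Gn n) (2 * n) x) * (x ^ 3 + 3 * x ^ 2)
      ≡⟨ cong (_* (x ^ 3 + 3 * x ^ 2)) (afPoly-weight n x) ⟨
    afPoly n x * (x ^ 3 + 3 * x ^ 2) ∎

-- The identity also holds for n = 0.
lemma4p4 : (n : ℕ) → 1 ≤ n → (x : ℕ) → afPoly n x ≡ (x ^ 3 + 3 * x ^ 2) ^ n
lemma4p4 n _ x = afPoly≡ n
  where
  afPoly≡ : ∀ n → afPoly n x ≡ (x ^ 3 + 3 * x ^ 2) ^ n
  afPoly≡ zero    = refl
  afPoly≡ (suc n) = begin
    afPoly (suc n) x                                ≡⟨ afPoly-suc n x ⟩
    afPoly n x * (x ^ 3 + 3 * x ^ 2)                ≡⟨ cong (_* (x ^ 3 + 3 * x ^ 2)) (afPoly≡ n) ⟩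
    (x ^ 3 + 3 * x ^ 2) ^ n * (x ^ 3 + 3 * x ^ 2)   ≡⟨ *-comm ((x ^ 3 + 3 * x ^ 2) ^ n) (x ^ 3 + 3 * x ^ 2) ⟩
    (x ^ 3 + 3 * x ^ 2) ^ suc n                     ∎
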